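{- Let $n \geq 2$ be an integer, let $V = \{0, 1, \dotsc, n\}$, and let $m = \binom{n+1}{2}$. Consider vectors $x \in \mathbb{R}^m$ whose coordinates $x_{ij} = x_{ji}$ are indexed by the unordered pairs $\{i,j\}$ of distinct elements of $V$. The following system of linear inequalities in $x$ is totally dual integral: \begin{align*} & x_{0n} \leq 1, \\ & x_{in} \leq x_{i-1,n} && \forall i \in \{1, \dotsc, n-1\}, \\ & x_{0i} \leq x_{0,i+1} && \forall i \in \{1, \dotsc, n-1\}, \\ & x_{i-1,i+1} \leq x_{i-1,i} + x_{i,i+1} && \forall i \in \{1, \dotsc, n-1\}, \\ & x_{j,k} + x_{j+1,k-1} \leq x_{j+1,k} + x_{j,k-1} && \forall j,k \in \{0, \dotsc, n\} \text{ with } j < k-2. \end{align*}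
   Context: A system of linear inequalities $Ax \leq b$ with $A \in \mathbb{Q}^{k \times m}$, $b \in \mathbb{Q}^k$ is called totally dual integral (TDI) if for every $c \in \mathbb{Z}^m$ such that the linear program $\max\{c^\top x \mid Ax \leq b\}$ is feasible and bounded, its dual linear program $\min\{b^\top y \mid A^\top y = c,\ y \geq 0\}$ has an integral optimal solution.
   Formalization: The vectors x have entries in ℚ rather than ℝ, and the dual solutions against which an integral dual solution must be optimal are likewise taken with rational entries. -}

module Defs where

open import Data.Nat as ℕ using (ℕ; zero; suc; _∸_; _<ᵇ_; _≡ᵇ_)
open import Data.Nat.Combinatorics using (_C_)
open import Data.Integer as ℤ using (ℤ)
open import Data.Rational using (ℚ; 0ℚ; 1ℚ; _+_; _-_; _*_; _≤_; _/_)
open import Data.Fin using (Fin; zero; suc; toℕ)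
open import Data.Bool using (if_then_else_)
open import Data.List using (List; []; _∷_; map; upTo; concatMap; length; lookup; _++_)
open import Data.Product using (_×_; _,_; proj₁; proj₂; ∃; ∃-syntax)
open import Relation.Binary.PropositionalEquality using (_≡_)

sumFin : ∀ {m} → (Fin m → ℚ) → ℚ
sumFin {zero}  f = 0ℚ
sumFin {suc m} f = f zero + sumFin (λ i → f (suc i))

dot : ∀ {m} → (Fin m → ℚ) → (Fin m → ℚ) → ℚ
dot x y = sumFin (λ i → x i * y i)

ℤ→ℚ : ℤ → ℚ
ℤ→ℚ z = z / 1

Feasible : ∀ {k m} → (Fin k → Fin m → ℚ) → (Fin k → ℚ) → (Fin m → ℚ) → Set
Feasible A b x = ∀ i → dot (A i) x ≤ b i

DualFeasible : ∀ {k m} → (Fin k → Fin m → ℚ) → (Fin m → ℚ) → (Fin k → ℚ) → Set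
DualFeasible A c y = (∀ i → 0ℚ ≤ y i) × (∀ j → sumFin (λ i → A i j * y i) ≡ c j)

TDI : ∀ {k m} → (Fin k → Fin m → ℚ) → (Fin k → ℚ) → Set
TDI {k} {m} A b =
  (c : Fin m → ℤ) →
  let c' : Fin m → ℚ
      c' = λ j → ℤ→ℚ (c j) in
  (∃[ x ] Feasible {k} {m} A b x) →
  (∃ λ (M : ℚ) → ∀ x → Feasible A b x → dot {m} c' x ≤ M) →
  ∃ λ (y : Fin k → ℤ) → (DualFeasible A c' (λ i → ℤ→ℚ (y i))
          × (∀ (z : Fin k → ℚ) → DualFeasible A c' z → dot {k} b (λ i → ℤ→ℚ (y i)) ≤ dot {k} b z))

-- Vertices V = {0,…,n} are natural numbers;
-- the unordered pair {i,j} (i < j) is encoded as coordinate  tri j + i,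
-- where tri j = 0+1+…+(j-1); this is a bijection from pairs of distinct
-- elements of {0..n} onto {0, …, C(n+1,2) - 1}.

tri : ℕ → ℕ
tri zero    = 0
tri (suc j) = tri j ℕ.+ j

code : ℕ → ℕ → ℕ
code i j = if i <ᵇ j then tri j ℕ.+ i else tri i ℕ.+ j

numVars : ℕ → ℕ
numVars n = suc n C 2

Vec' : ℕ → Set
Vec' n = Fin (numVars n) → ℚ

unit : (n : ℕ) → ℕ → ℕ → Vec' n
unit n i j p = if toℕ p ≡ᵇ code i j then 1ℚ else 0ℚ

_⊕_ _⊖_ : ∀ {m} → (Fin m → ℚ) → (Fin m → ℚ) → Fin m → ℚ
(u ⊕ v) p = u p + v p
(u ⊖ v) p = u p - v p
infixl 6 _⊕_ _⊖_

-- each constraint  a·x ≤ β  is stored as (a , β)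
Constraint : ℕ → Set
Constraint n = Vec' n × ℚ

mid : ℕ → List ℕ
mid n = map suc (upTo (n ∸ 1))

system : (n : ℕ) → List (Constraint n)
system n =
  let e = unit n in
  (e 0 n , 1ℚ)
  ∷ map (λ i → (e i n ⊖ e (i ∸ 1) n , 0ℚ)) (mid n)
  ++ map (λ i → (e 0 i ⊖ e 0 (suc i) , 0ℚ)) (mid n)
  ++ map (λ i → (e (i ∸ 1) (suc i) ⊖ e (i ∸ 1) i ⊖ e i (suc i) , 0ℚ)) (mid n)
  ++ concatMap (λ k → map (λ j →
        (e j k ⊕ e (suc j) (k ∸ 1) ⊖ e (suc j) k ⊖ e j (k ∸ 1) , 0ℚ))
        (upTo (k ∸ 2)))
      (upTo (suc n))

numCons : ℕ → ℕ
numCons n = length (system n)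

Amat : (n : ℕ) → Fin (numCons n) → Fin (numVars n) → ℚ
Amat n r = proj₁ (lookup (system n) r)

bvec : (n : ℕ) → Fin (numCons n) → ℚ
bvec n r = proj₂ (lookup (system n) r)

-- Test the dual equations Aᵀ y = c against the rectangle vectors rect p q (0 ≤ p < q ≤ n),
-- the indicators of the pairs {a < b} with a ≤ p and q ≤ b; by inclusion–exclusion they span
-- the coordinate space, and every inequality takes a value in {0, ±1} on them. The equation at
-- (p, q) reads  y₀ − α p − β (q − 1) + γ p q = g p q  with g p q = c · rect p q ∈ ℤ, where y₀,
-- α p, β i and γ p q are the dual weights of x₀ₙ ≤ 1, of x_{p+1,n} ≤ x_{p,n}, of x₀ᵢ ≤ x₀,ᵢ₊₁
-- and of the triangle (q = p + 2) or square (q ≥ p + 3) inequality at (p, q), with γ p (p+1) = 0.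
-- Solving for β and γ, dual feasibility becomes  α j ≥ α k − (g j (k+1) − g k (k+1))  for
-- j < k < n and  y₀ ≥ α k + g k (k+1):  a longest-path problem with integral data. Its least
-- solution yields an integral dual of cost y₀ = maxₖ (α k + g k (k+1)), and the same path
-- inequalities bound the cost of every rational dual solution from below by y₀.

module Submission where

open import Defs
open import Data.Integer using (ℤ)
open import Data.Rational using (0ℚ; 1ℚ)
open import Data.Nat as ℕ using (ℕ; zero; suc; z≤n; s≤s; _∸_; _<ᵇ_; _≤ᵇ_; _≡ᵇ_)
import Data.Nat.Properties as ℕₚ
open import Data.Nat.Combinatorics using (_C_; nCk+nC[k+1]≡[n+1]C[k+1]; nC1≡n)
open import Data.Bool using (Bool; true; false; T; if_then_else_; _∧_)
open import Data.Bool.Properties using (T-≡)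
open import Function.Bundles using (Equivalence)
open import Data.Fin using (Fin; zero; suc; toℕ; fromℕ<)
import Data.Fin.Properties as Finₚ
open import Data.List using (List; []; _∷_; map; upTo; applyUpTo; concatMap; length; lookup; _++_)
import Data.List.Properties as Listₚ
open import Data.List.Relation.Unary.All using (All; []; _∷_)
import Data.List.Relation.Unary.All.Properties as Allₚ
open import Data.Product using (_×_; _,_; proj₁; proj₂; uncurry; ∃)
open import Data.Sum using (_⊎_; inj₁; inj₂)
open import Data.Empty using (⊥-elim)
open import Data.Unit using (⊤; tt)
open import Function using (_∘_)
open import Relation.Binary.Definitions using (tri<; tri≈; tri>)
open import Relation.Nullary using (yes; no)
open import Relation.Binary.PropositionalEquality

-- Unordered pairs {a < b} as coordinates

≡ᵇ-refl : ∀ x → (x ≡ᵇ x) ≡ true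
≡ᵇ-refl x = Equivalence.to T-≡ (ℕₚ.≡⇒≡ᵇ x x refl)

≢⇒≡ᵇ-false : ∀ {x y} → x ≢ y → (x ≡ᵇ y) ≡ false
≢⇒≡ᵇ-false {x} {y} x≢y with x ≡ᵇ y in eq
... | true  = ⊥-elim (x≢y (ℕₚ.≡ᵇ⇒≡ x y (Equivalence.from T-≡ eq)))
... | false = refl

≡ᵇ-sym : ∀ x y → (x ≡ᵇ y) ≡ (y ≡ᵇ x)
≡ᵇ-sym zero    zero    = refl
≡ᵇ-sym zero    (suc y) = refl
≡ᵇ-sym (suc x) zero    = refl
≡ᵇ-sym (suc x) (suc y) = ≡ᵇ-sym x y

≤⇒<ᵇ-false : ∀ {b n} → b ℕ.≤ n → (n <ᵇ b) ≡ false
≤⇒<ᵇ-false {b} {n} b≤n with n <ᵇ b in n<ᵇb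
... | true  = ⊥-elim (ℕₚ.<⇒≱ (ℕₚ.<ᵇ⇒< n b (Equivalence.from T-≡ n<ᵇb)) b≤n)
... | false = refl

<ᵇ-suc : ∀ a k → (a <ᵇ suc k) ≡ (a ≤ᵇ k)
<ᵇ-suc zero    k = refl
<ᵇ-suc (suc a) k = refl

C2≡tri : ∀ m → m C 2 ≡ tri m
C2≡tri zero    = refl
C2≡tri (suc m) = begin
  suc m C 2           ≡⟨ nCk+nC[k+1]≡[n+1]C[k+1] m 1 ⟨
  m C 1 ℕ.+ m C 2     ≡⟨ cong₂ ℕ._+_ (nC1≡n m) (C2≡tri m) ⟩
  m ℕ.+ tri m         ≡⟨ ℕₚ.+-comm m (tri m) ⟩
  tri (suc m)         ∎
  where open ≡-Reasoning

numVars≡tri : ∀ n → numVars n ≡ tri (suc n)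
numVars≡tri n = C2≡tri (suc n)

tri-mono-≤ : ∀ {b c} → b ℕ.≤ c → tri b ℕ.≤ tri c
tri-mono-≤ {c = zero}  z≤n = ℕₚ.≤-refl
tri-mono-≤ {b} {suc c} b≤1+c with ℕₚ.m≤n⇒m<n∨m≡n b≤1+c
... | inj₁ b<1+c = ℕₚ.≤-trans (tri-mono-≤ (ℕₚ.≤-pred b<1+c)) (ℕₚ.m≤m+n (tri c) c)
... | inj₂ refl  = ℕₚ.≤-refl

tri+<tri : ∀ {a b c} → a ℕ.< b → b ℕ.< c → tri b ℕ.+ a ℕ.< tri c
tri+<tri {a} {b} a<b b<c = ℕₚ.<-≤-trans (ℕₚ.+-monoʳ-< (tri b) a<b) (tri-mono-≤ b<c)

tri+-injective : ∀ {a b a′ b′} → a ℕ.< b → a′ ℕ.< b′ →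
                 tri b ℕ.+ a ≡ tri b′ ℕ.+ a′ → a ≡ a′ × b ≡ b′
tri+-injective {a} {b} {a′} {b′} a<b a′<b′ eq with ℕₚ.<-cmp b b′
... | tri< b<b′ _ _ = ⊥-elim (ℕₚ.<-irrefl eq (ℕₚ.<-≤-trans (tri+<tri a<b b<b′) (ℕₚ.m≤m+n _ a′)))
... | tri≈ _ refl _ = ℕₚ.+-cancelˡ-≡ (tri b) a a′ eq , refl
... | tri> _ _ b′<b = ⊥-elim (ℕₚ.<-irrefl (sym eq) (ℕₚ.<-≤-trans (tri+<tri a′<b′ b′<b) (ℕₚ.m≤m+n _ a)))

code≡tri+ : ∀ {a b} → a ℕ.< b → code a b ≡ tri b ℕ.+ a
code≡tri+ a<b rewrite Equivalence.to T-≡ (ℕₚ.<⇒<ᵇ a<b) = refl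

code<numVars : ∀ {n a b} → a ℕ.< b → b ℕ.≤ n → code a b ℕ.< numVars n
code<numVars {n} a<b b≤n = subst₂ ℕ._<_ (sym (code≡tri+ a<b)) (sym (numVars≡tri n)) (tri+<tri a<b (s≤s b≤n))

-- decode inverts tri b + a ↦ (a , b) by enumerating the pairs in the order (0,1), (0,2), (1,2), (0,3), …
next : ℕ × ℕ → ℕ × ℕ
next (a , b) = if suc a <ᵇ b then (suc a , b) else (0 , suc b)

decode : ℕ → ℕ × ℕ
decode zero    = 0 , 1
decode (suc x) = next (decode x)

Codes : ℕ × ℕ → ℕ → Set
Codes (a , b) x = a ℕ.< b × tri b ℕ.+ a ≡ x

next-codes : ∀ {x} p → Codes p x → Codes (next p) (suc x)
next-codes (a , b) (a<b , refl) with suc a <ᵇ b in lt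
... | true  = ℕₚ.<ᵇ⇒< (suc a) b (Equivalence.from T-≡ lt) , ℕₚ.+-suc (tri b) a
... | false = s≤s z≤n , (begin
  tri b ℕ.+ b ℕ.+ 0   ≡⟨ ℕₚ.+-identityʳ _ ⟩
  tri b ℕ.+ b         ≡⟨ cong (tri b ℕ.+_) b≡1+a ⟩
  tri b ℕ.+ suc a     ≡⟨ ℕₚ.+-suc (tri b) a ⟩
  suc (tri b ℕ.+ a)   ∎)
  where
  open ≡-Reasoning
  b≡1+a : b ≡ suc a
  b≡1+a = ℕₚ.≤-antisym (ℕₚ.≮⇒≥ (λ 1+a<b → subst T lt (ℕₚ.<⇒<ᵇ 1+a<b))) a<b

decode-codes : ∀ x → Codes (decode x) x
decode-codes zero    = s≤s z≤n , refl
decode-codes (suc x) = next-codes (decode x) (decode-codes x)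

decode-tri+ : ∀ {a b} → a ℕ.< b → decode (tri b ℕ.+ a) ≡ (a , b)
decode-tri+ {a} {b} a<b =
  let lt , eq = decode-codes (tri b ℕ.+ a)
  in  uncurry (cong₂ _,_) (tri+-injective lt a<b eq)

decode-bound : ∀ n x → x ℕ.< tri (suc n) → proj₂ (decode x) ℕ.≤ n
decode-bound n x x<tri = ℕₚ.≮⇒≥ λ n<b → ℕₚ.<-irrefl refl (ℕₚ.<-≤-trans x<tri (begin
  tri (suc n)                              ≤⟨ tri-mono-≤ n<b ⟩
  tri (proj₂ (decode x))                   ≤⟨ ℕₚ.m≤m+n _ _ ⟩
  tri (proj₂ (decode x)) ℕ.+ proj₁ (decode x) ≡⟨ proj₂ (decode-codes x) ⟩
  x                                        ∎))
  where open ℕₚ.≤-Reasoning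

≡ᵇ-tri+ : ∀ {a b i j} → a ℕ.< b → i ℕ.< j →
         (tri b ℕ.+ a ≡ᵇ tri j ℕ.+ i) ≡ ((a ≡ᵇ i) ∧ (b ≡ᵇ j))
≡ᵇ-tri+ {a} {b} {i} {j} a<b i<j with a ℕ.≟ i | b ℕ.≟ j
... | yes refl | yes refl rewrite ≡ᵇ-refl (tri b ℕ.+ a) | ≡ᵇ-refl a | ≡ᵇ-refl b = refl
... | no a≢i   | _ rewrite ≢⇒≡ᵇ-false a≢i =
  ≢⇒≡ᵇ-false (a≢i ∘ proj₁ ∘ tri+-injective a<b i<j)
... | yes refl | no b≢j rewrite ≢⇒≡ᵇ-false b≢j | ≡ᵇ-refl a =
  ≢⇒≡ᵇ-false (b≢j ∘ proj₂ ∘ tri+-injective a<b i<j)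

-- The inequalities of the system

module _ {A B : Set} (f : A → B) where

  preimage : (xs : List A) → Fin (length (map f xs)) → Fin (length xs)
  preimage (x ∷ xs) zero    = zero
  preimage (x ∷ xs) (suc i) = suc (preimage xs i)

  origin : ∀ {ys} xs → ys ≡ map f xs → Fin (length ys) → A
  origin xs refl i = lookup xs (preimage xs i)

  lookup-origin : ∀ {ys} xs (ys≡ : ys ≡ map f xs) i → lookup ys i ≡ f (origin xs ys≡ i)
  lookup-origin (x ∷ xs) refl zero    = refl
  lookup-origin (x ∷ xs) refl (suc i) = lookup-origin xs refl i

  All-origin : ∀ {P : A → Set} {ys xs} → All P xs → (ys≡ : ys ≡ map f xs) → ∀ i → P (origin xs ys≡ i)
  All-origin (px ∷ pxs) refl zero    = px
  All-origin (px ∷ pxs) refl (suc i) = All-origin pxs refl i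

data Ineq : Set where
  cap                   : Ineq
  column row triangle   : ℕ → Ineq
  square                : ℕ → ℕ → Ineq

module _ (n : ℕ) where

  ineq : Ineq → Constraint n
  ineq cap          = unit n 0 n , 1ℚ
  ineq (column i)   = unit n i n ⊖ unit n (i ∸ 1) n , 0ℚ
  ineq (row i)      = unit n 0 i ⊖ unit n 0 (suc i) , 0ℚ
  ineq (triangle i) = unit n (i ∸ 1) (suc i) ⊖ unit n (i ∸ 1) i ⊖ unit n i (suc i) , 0ℚ
  ineq (square j k) = unit n j k ⊕ unit n (suc j) (k ∸ 1) ⊖ unit n (suc j) k ⊖ unit n j (k ∸ 1) , 0ℚ

  squares : ℕ → List Ineq
  squares k = map (λ j → square j k) (upTo (k ∸ 2))

  ineqs : List Ineq
  ineqs = cap ∷ map column (mid n) ++ map row (mid n) ++ map triangle (mid n)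
              ++ concatMap squares (upTo (suc n))

  system≡map-ineq : system n ≡ map ineq ineqs
  system≡map-ineq = cong (ineq cap ∷_) (sym
    (trans (map-map-++ column) (cong (map (ineq ∘ column) (mid n) ++_)
    (trans (map-map-++ row) (cong (map (ineq ∘ row) (mid n) ++_)
    (trans (map-map-++ triangle) (cong (map (ineq ∘ triangle) (mid n) ++_)
    (trans (Listₚ.map-concatMap ineq squares (upTo (suc n)))
           (Listₚ.concatMap-cong (λ k → sym (Listₚ.map-∘ (upTo (k ∸ 2)))) (upTo (suc n)))))))))))
    where
    map-map-++ : ∀ (g : ℕ → Ineq) {ys} → map ineq (map g (mid n) ++ ys) ≡ map (ineq ∘ g) (mid n) ++ map ineq ys
    map-map-++ g {ys} = trans (Listₚ.map-++ ineq (map g (mid n)) ys) (cong (_++ map ineq ys) (sym (Listₚ.map-∘ (mid n))))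

  ineqAt : Fin (numCons n) → Ineq
  ineqAt = origin ineq ineqs system≡map-ineq

  Amat≡ineqAt : ∀ r → Amat n r ≡ proj₁ (ineq (ineqAt r))
  Amat≡ineqAt r = cong proj₁ (lookup-origin ineq ineqs system≡map-ineq r)

  bvec≡ineqAt : ∀ r → bvec n r ≡ proj₂ (ineq (ineqAt r))
  bvec≡ineqAt r = cong proj₂ (lookup-origin ineq ineqs system≡map-ineq r)

  Inner : ℕ → Set
  Inner i = 1 ℕ.≤ i × i ℕ.< n

  Valid : Ineq → Set
  Valid cap          = ⊤
  Valid (column i)   = Inner i
  Valid (row i)      = Inner i
  Valid (triangle i) = Inner i
  Valid (square j k) = 3 ℕ.+ j ℕ.≤ k × k ℕ.≤ n

  valid-ineqs : All Valid ineqs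
  valid-ineqs = tt ∷ Allₚ.++⁺ (Allₚ.map⁺ inner-mid) (Allₚ.++⁺ (Allₚ.map⁺ inner-mid)
    (Allₚ.++⁺ (Allₚ.map⁺ inner-mid) (Allₚ.concat⁺ (Allₚ.map⁺
      (Allₚ.applyUpTo⁺₁ {P = All Valid ∘ squares} _ (suc n) (valid-squares ∘ ℕₚ.≤-pred))))))
    where
    inner-mid : All Inner (mid n)
    inner-mid = Allₚ.map⁺ (Allₚ.applyUpTo⁺₁ _ (n ∸ 1) (λ t<n∸1 → s≤s z≤n , <∸1⇒1+< n t<n∸1))
      where
      <∸1⇒1+< : ∀ {t} m → t ℕ.< m ∸ 1 → suc t ℕ.< m
      <∸1⇒1+< (suc m) t<m = s≤s t<m
    valid-squares : ∀ {k} → k ℕ.≤ n → All Valid (squares k)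
    valid-squares {k} k≤n = Allₚ.map⁺ (Allₚ.applyUpTo⁺₁ {P = λ j → Valid (square j k)} _ (k ∸ 2) (valid-square k≤n))
      where
      valid-square : ∀ {j k} → k ℕ.≤ n → j ℕ.< k ∸ 2 → Valid (square j k)
      valid-square {k = suc (suc k)} k≤n j<k = s≤s (s≤s j<k) , k≤n

  valid-ineqAt : ∀ r → Valid (ineqAt r)
  valid-ineqAt = All-origin ineq valid-ineqs system≡map-ineq

-- Indicator algebra over ℤ

module Indicators where

  open import Data.Integer as ℤ using (ℤ; 0ℤ; 1ℤ; _+_; _-_; _*_; -_; _≤_)
  import Data.Integer.Properties as ℤₚ
  open import Data.Integer.Solver using (module +-*-Solver)
  open +-*-Solver

  𝟙 : Bool → ℤ
  𝟙 true  = 1ℤ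
  𝟙 false = 0ℤ

  𝟙-∧ : ∀ x y → 𝟙 (x ∧ y) ≡ 𝟙 x * 𝟙 y
  𝟙-∧ true  y = sym (ℤₚ.*-identityˡ (𝟙 y))
  𝟙-∧ false y = sym (ℤₚ.*-zeroˡ (𝟙 y))

  𝟙-≤ᵇ-suc : ∀ a i → 𝟙 (a ≤ᵇ suc i) - 𝟙 (a ≤ᵇ i) ≡ 𝟙 (a ≡ᵇ suc i)
  𝟙-≤ᵇ-suc zero          i       = refl
  𝟙-≤ᵇ-suc (suc zero)    zero    = refl
  𝟙-≤ᵇ-suc (suc (suc a)) zero    = refl
  𝟙-≤ᵇ-suc (suc a)       (suc i) rewrite <ᵇ-suc a (suc i) | <ᵇ-suc a i = 𝟙-≤ᵇ-suc a i

  𝟙-≤ᵇ-zero : ∀ a → 𝟙 (a ≤ᵇ 0) ≡ 𝟙 (a ≡ᵇ 0)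
  𝟙-≤ᵇ-zero zero    = refl
  𝟙-≤ᵇ-zero (suc a) = refl

  𝟙-suc-≤ᵇ : ∀ j b → 𝟙 (j ≤ᵇ b) - 𝟙 (suc j ≤ᵇ b) ≡ 𝟙 (j ≡ᵇ b)
  𝟙-suc-≤ᵇ zero    zero          = refl
  𝟙-suc-≤ᵇ zero    (suc zero)    = refl
  𝟙-suc-≤ᵇ zero    (suc (suc b)) = refl
  𝟙-suc-≤ᵇ (suc j) zero          = refl
  𝟙-suc-≤ᵇ (suc j) (suc b) rewrite <ᵇ-suc j b | sym (<ᵇ-suc (suc j) b) = 𝟙-suc-≤ᵇ j b

  inRect : ℕ → ℕ → ℕ → ℕ → ℤ
  inRect p q a b = 𝟙 (a ≤ᵇ p) * 𝟙 (q ≤ᵇ b)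

  inRect-corner : ∀ i j a b →
    (inRect (suc i) j a b - inRect (suc i) (suc j) a b) - (inRect i j a b - inRect i (suc j) a b)
      ≡ 𝟙 ((a ≡ᵇ suc i) ∧ (b ≡ᵇ j))
  inRect-corner i j a b = begin
    _
      ≡⟨ solve 4 (λ x x′ y y′ → (x′ :* y :- x′ :* y′) :- (x :* y :- x :* y′) := (x′ :- x) :* (y :- y′))
                 refl (𝟙 (a ≤ᵇ i)) (𝟙 (a ≤ᵇ suc i)) (𝟙 (j ≤ᵇ b)) (𝟙 (suc j ≤ᵇ b)) ⟩
    (𝟙 (a ≤ᵇ suc i) - 𝟙 (a ≤ᵇ i)) * (𝟙 (j ≤ᵇ b) - 𝟙 (suc j ≤ᵇ b))
      ≡⟨ cong₂ _*_ (𝟙-≤ᵇ-suc a i) (trans (𝟙-suc-≤ᵇ j b) (cong 𝟙 (≡ᵇ-sym j b))) ⟩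
    𝟙 (a ≡ᵇ suc i) * 𝟙 (b ≡ᵇ j)
      ≡⟨ 𝟙-∧ (a ≡ᵇ suc i) (b ≡ᵇ j) ⟨
    _ ∎
    where open ≡-Reasoning

  inRect-corner₀ : ∀ j a b → inRect 0 j a b - inRect 0 (suc j) a b ≡ 𝟙 ((a ≡ᵇ 0) ∧ (b ≡ᵇ j))
  inRect-corner₀ j a b = begin
    _
      ≡⟨ solve 3 (λ x y y′ → x :* y :- x :* y′ := x :* (y :- y′)) refl (𝟙 (a ≤ᵇ 0)) (𝟙 (j ≤ᵇ b)) (𝟙 (suc j ≤ᵇ b)) ⟩
    𝟙 (a ≤ᵇ 0) * (𝟙 (j ≤ᵇ b) - 𝟙 (suc j ≤ᵇ b))
      ≡⟨ cong₂ _*_ (𝟙-≤ᵇ-zero a) (trans (𝟙-suc-≤ᵇ j b) (cong 𝟙 (≡ᵇ-sym j b))) ⟩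
    𝟙 (a ≡ᵇ 0) * 𝟙 (b ≡ᵇ j)
      ≡⟨ 𝟙-∧ (a ≡ᵇ 0) (b ≡ᵇ j) ⟨
    _ ∎
    where open ≡-Reasoning

  inRect-diagonal : ∀ {p q} a → p ℕ.< q → inRect p q a a ≡ 0ℤ
  inRect-diagonal {p} {q} a p<q with a ≤ᵇ p in a≤p | q ≤ᵇ a in q≤a
  ... | true  | true  = ⊥-elim (ℕₚ.<⇒≱ p<q
    (ℕₚ.≤-trans (ℕₚ.≤ᵇ⇒≤ q a (Equivalence.from T-≡ q≤a)) (ℕₚ.≤ᵇ⇒≤ a p (Equivalence.from T-≡ a≤p))))
  ... | true  | false = refl
  ... | false | _     = refl

  rectValue : Ineq → ℕ → ℕ → ℤ
  rectValue cap          p q = 1ℤ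
  rectValue (column i)   p q = - 𝟙 (i ≡ᵇ suc p)
  rectValue (row i)      p q = - 𝟙 (suc i ≡ᵇ q)
  rectValue (triangle i) p q = 𝟙 ((i ≡ᵇ suc p) ∧ (q ≡ᵇ suc i))
  rectValue (square j k) p q = 𝟙 ((j ≡ᵇ p) ∧ (k ≡ᵇ q))

  module _ {p q : ℕ} where
    open ≡-Reasoning

    inRect-cap : ∀ {n} → q ℕ.≤ n → inRect p q 0 n ≡ rectValue cap p q
    inRect-cap q≤n rewrite Equivalence.to T-≡ (ℕₚ.≤⇒≤ᵇ q≤n) = refl

    inRect-column : ∀ {n} i → q ℕ.≤ n → inRect p q (suc i) n - inRect p q i n ≡ rectValue (column (suc i)) p q
    inRect-column i q≤n rewrite Equivalence.to T-≡ (ℕₚ.≤⇒≤ᵇ q≤n) = begin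
      _
        ≡⟨ solve 2 (λ x x′ → x′ :* con 1ℤ :- x :* con 1ℤ := :- (x :- x′)) refl (𝟙 (i ≤ᵇ p)) (𝟙 (suc i ≤ᵇ p)) ⟩
      - (𝟙 (i ≤ᵇ p) - 𝟙 (suc i ≤ᵇ p))
        ≡⟨ cong -_ (𝟙-suc-≤ᵇ i p) ⟩
      _ ∎

    inRect-row : ∀ i → inRect p q 0 i - inRect p q 0 (suc i) ≡ rectValue (row i) p q
    inRect-row i = begin
      _
        ≡⟨ solve 2 (λ y y′ → con 1ℤ :* y :- con 1ℤ :* y′ := :- (y′ :- y)) refl (𝟙 (q ≤ᵇ i)) (𝟙 (q ≤ᵇ suc i)) ⟩
      - (𝟙 (q ≤ᵇ suc i) - 𝟙 (q ≤ᵇ i))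
        ≡⟨ cong -_ (trans (𝟙-≤ᵇ-suc q i) (cong 𝟙 (≡ᵇ-sym q (suc i)))) ⟩
      _ ∎

    inRect-triangle : ∀ i → p ℕ.< q →
      inRect p q i (suc (suc i)) - inRect p q i (suc i) - inRect p q (suc i) (suc (suc i))
        ≡ rectValue (triangle (suc i)) p q
    inRect-triangle i p<q = begin
      _
        ≡⟨ solve 4 (λ x x′ y y′ → x :* y′ :- x :* y :- x′ :* y′ := (x :- x′) :* (y′ :- y) :- x′ :* y)
                   refl (𝟙 (i ≤ᵇ p)) (𝟙 (suc i ≤ᵇ p)) (𝟙 (q ≤ᵇ suc i)) (𝟙 (q ≤ᵇ suc (suc i))) ⟩
      (𝟙 (i ≤ᵇ p) - 𝟙 (suc i ≤ᵇ p)) * (𝟙 (q ≤ᵇ suc (suc i)) - 𝟙 (q ≤ᵇ suc i)) - inRect p q (suc i) (suc i)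
        ≡⟨ cong₂ _-_ (cong₂ _*_ (𝟙-suc-≤ᵇ i p) (𝟙-≤ᵇ-suc q (suc i))) (inRect-diagonal (suc i) p<q) ⟩
      𝟙 (i ≡ᵇ p) * 𝟙 (q ≡ᵇ suc (suc i)) - 0ℤ
        ≡⟨ ℤₚ.+-identityʳ _ ⟩
      𝟙 (i ≡ᵇ p) * 𝟙 (q ≡ᵇ suc (suc i))
        ≡⟨ 𝟙-∧ (i ≡ᵇ p) (q ≡ᵇ suc (suc i)) ⟨
      _ ∎

    inRect-square : ∀ j k →
      inRect p q j (suc k) + inRect p q (suc j) k - inRect p q (suc j) (suc k) - inRect p q j k
        ≡ rectValue (square j (suc k)) p q
    inRect-square j k = begin
      _
        ≡⟨ solve 4 (λ x x′ y y′ → x :* y′ :+ x′ :* y :- x′ :* y′ :- x :* y := (x :- x′) :* (y′ :- y))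
                   refl (𝟙 (j ≤ᵇ p)) (𝟙 (suc j ≤ᵇ p)) (𝟙 (q ≤ᵇ k)) (𝟙 (q ≤ᵇ suc k)) ⟩
      (𝟙 (j ≤ᵇ p) - 𝟙 (suc j ≤ᵇ p)) * (𝟙 (q ≤ᵇ suc k) - 𝟙 (q ≤ᵇ k))
        ≡⟨ cong₂ _*_ (𝟙-suc-≤ᵇ j p) (trans (𝟙-≤ᵇ-suc q k) (cong 𝟙 (≡ᵇ-sym q (suc k)))) ⟩
      𝟙 (j ≡ᵇ p) * 𝟙 (suc k ≡ᵇ q)
        ≡⟨ 𝟙-∧ (j ≡ᵇ p) (suc k ≡ᵇ q) ⟨
      _ ∎

  _==_ : Ineq → Ineq → Bool
  cap        == cap        = true
  column i   == column j   = i ≡ᵇ j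
  row i      == row j      = i ≡ᵇ j
  triangle i == triangle j = i ≡ᵇ j
  square i j == square k l = (i ≡ᵇ k) ∧ (j ≡ᵇ l)
  _          == _          = false

  δ : Ineq → Ineq → ℤ
  δ m ℓ = 𝟙 (ℓ == m)

  𝟙-nonneg : ∀ b → 0ℤ ≤ 𝟙 b
  𝟙-nonneg true  = ℤ.+≤+ z≤n
  𝟙-nonneg false = ℤₚ.≤-refl

  rectValue-split : ∀ ℓ p q → rectValue ℓ p (suc q) ≡
    δ cap ℓ - δ (column (suc p)) ℓ - δ (row q) ℓ + 𝟙 (q ≡ᵇ suc p) * δ (triangle (suc p)) ℓ + δ (square p (suc q)) ℓ
  rectValue-split cap p q =
    solve 1 (λ c → con 1ℤ := con 1ℤ :- con 0ℤ :- con 0ℤ :+ c :* con 0ℤ :+ con 0ℤ) refl (𝟙 (q ≡ᵇ suc p))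
  rectValue-split (column i) p q =
    solve 2 (λ x c → :- x := con 0ℤ :- x :- con 0ℤ :+ c :* con 0ℤ :+ con 0ℤ)
            refl (𝟙 (i ≡ᵇ suc p)) (𝟙 (q ≡ᵇ suc p))
  rectValue-split (row i) p q =
    solve 2 (λ x c → :- x := con 0ℤ :- con 0ℤ :- x :+ c :* con 0ℤ :+ con 0ℤ)
            refl (𝟙 (i ≡ᵇ q)) (𝟙 (q ≡ᵇ suc p))
  rectValue-split (triangle i) p q = trans triangle-factor
    (solve 1 (λ x → x := con 0ℤ :- con 0ℤ :- con 0ℤ :+ x :+ con 0ℤ) refl (𝟙 (q ≡ᵇ suc p) * 𝟙 (i ≡ᵇ suc p)))
    where
    triangle-factor : 𝟙 ((i ≡ᵇ suc p) ∧ (q ≡ᵇ i)) ≡ 𝟙 (q ≡ᵇ suc p) * 𝟙 (i ≡ᵇ suc p)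
    triangle-factor with i ≡ᵇ suc p in i≡ᵇ1+p
    ... | false = sym (ℤₚ.*-zeroʳ (𝟙 (q ≡ᵇ suc p)))
    ... | true rewrite ℕₚ.≡ᵇ⇒≡ i (suc p) (Equivalence.from T-≡ i≡ᵇ1+p) = sym (ℤₚ.*-identityʳ (𝟙 (q ≡ᵇ suc p)))
  rectValue-split (square j k) p q =
    solve 2 (λ x c → x := con 0ℤ :- con 0ℤ :- con 0ℤ :+ c :* con 0ℤ :+ x)
            refl (𝟙 ((j ≡ᵇ p) ∧ (k ≡ᵇ suc q))) (𝟙 (q ≡ᵇ suc p))

  δ-square-adjacent : ∀ {n} ℓ → Valid n ℓ → ∀ p → δ (square p (suc p)) ℓ ≡ 0ℤ
  δ-square-adjacent cap          _ p = refl
  δ-square-adjacent (column _)   _ p = refl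
  δ-square-adjacent (row _)      _ p = refl
  δ-square-adjacent (triangle _) _ p = refl
  δ-square-adjacent (square j k) (3+j≤k , _) p with j ≡ᵇ p in j≡ᵇp
  ... | false = refl
  ... | true rewrite ℕₚ.≡ᵇ⇒≡ j p (Equivalence.from T-≡ j≡ᵇp) =
    cong 𝟙 (≢⇒≡ᵇ-false (λ k≡1+p → ℕₚ.<-irrefl (sym k≡1+p) (ℕₚ.≤-trans (s≤s (ℕₚ.n≤1+n (suc p))) 3+j≤k)))

-- The integral dual solution

module IntegerFolds where

  open import Data.Integer using (ℤ; 0ℤ; 1ℤ; _+_; _*_; -_; _≤_; _⊔_)
  import Data.Integer.Properties as ℤₚ
  open Indicators using (𝟙)

  maxUpTo : ℕ → (ℕ → ℤ) → ℤ
  maxUpTo zero    h = 0ℤ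
  maxUpTo (suc m) h = h 0 ⊔ maxUpTo m (λ t → h (suc t))

  maxUpTo-nonneg : ∀ m h → 0ℤ ≤ maxUpTo m h
  maxUpTo-nonneg zero    h = ℤₚ.≤-refl
  maxUpTo-nonneg (suc m) h = ℤₚ.≤-trans (maxUpTo-nonneg m (λ t → h (suc t))) (ℤₚ.i≤j⊔i (h 0) _)

  maxUpTo-≥ : ∀ m h {t} → t ℕ.< m → h t ≤ maxUpTo m h
  maxUpTo-≥ (suc m) h {zero}  _         = ℤₚ.i≤i⊔j (h 0) _
  maxUpTo-≥ (suc m) h {suc t} (s≤s t<m) = ℤₚ.≤-trans (maxUpTo-≥ m (λ t → h (suc t)) t<m) (ℤₚ.i≤j⊔i (h 0) _)

  maxUpTo-mono : ∀ m {h h′} → (∀ t → h t ≤ h′ t) → maxUpTo m h ≤ maxUpTo m h′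
  maxUpTo-mono zero    h≤h′ = ℤₚ.≤-refl
  maxUpTo-mono (suc m) h≤h′ = ℤₚ.⊔-mono-≤ (h≤h′ 0) (maxUpTo-mono m (h≤h′ ∘ ℕ.suc))

  maxUpTo-attained : ∀ m h → maxUpTo m h ≡ 0ℤ ⊎ ∃ λ t → t ℕ.< m × maxUpTo m h ≡ h t
  maxUpTo-attained zero    h = inj₁ refl
  maxUpTo-attained (suc m) h with ℤₚ.⊔-sel (h 0) (maxUpTo m (λ t → h (suc t))) | maxUpTo-attained m (λ t → h (suc t))
  ... | inj₁ eq | _                     = inj₂ (0 , s≤s z≤n , eq)
  ... | inj₂ eq | inj₁ eq′              = inj₁ (trans eq eq′)
  ... | inj₂ eq | inj₂ (t , t<m , eq′) = inj₂ (suc t , s≤s t<m , trans eq eq′)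

  sumUpTo : ℕ → (ℕ → ℤ) → ℤ
  sumUpTo zero    h = 0ℤ
  sumUpTo (suc m) h = h 0 + sumUpTo m (λ t → h (suc t))

  sumUpTo-cong : ∀ m {h h′} → (∀ t → h t ≡ h′ t) → sumUpTo m h ≡ sumUpTo m h′
  sumUpTo-cong zero    h≗h′ = refl
  sumUpTo-cong (suc m) h≗h′ = cong₂ _+_ (h≗h′ 0) (sumUpTo-cong m (h≗h′ ∘ ℕ.suc))

  sumUpTo-zero : ∀ m {h} → (∀ t → h t ≡ 0ℤ) → sumUpTo m h ≡ 0ℤ
  sumUpTo-zero zero    h≗0 = refl
  sumUpTo-zero (suc m) h≗0 = cong₂ _+_ (h≗0 0) (sumUpTo-zero m (h≗0 ∘ ℕ.suc))

  sumUpTo-*ʳ : ∀ m h c → sumUpTo m (λ t → h t * c) ≡ sumUpTo m h * c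
  sumUpTo-*ʳ zero    h c = sym (ℤₚ.*-zeroˡ c)
  sumUpTo-*ʳ (suc m) h c = trans (cong (h 0 * c +_) (sumUpTo-*ʳ m (λ t → h (suc t)) c)) (sym (ℤₚ.*-distribʳ-+ c (h 0) _))

  sumUpTo-neg : ∀ m h → sumUpTo m (λ t → - h t) ≡ - sumUpTo m h
  sumUpTo-neg zero    h = refl
  sumUpTo-neg (suc m) h = trans (cong (- h 0 +_) (sumUpTo-neg m (λ t → h (suc t)))) (sym (ℤₚ.neg-distrib-+ (h 0) _))

  sumUpTo-*-neg : ∀ m (h c : ℕ → ℤ) → sumUpTo m (λ t → h t * - c t) ≡ - sumUpTo m (λ t → h t * c t)
  sumUpTo-*-neg m h c = trans (sumUpTo-cong m (λ t → sym (ℤₚ.neg-distribʳ-* (h t) (c t)))) (sumUpTo-neg m (λ t → h t * c t))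

  sumUpTo-𝟙 : ∀ m h {x} → x ℕ.< m → sumUpTo m (λ t → h t * 𝟙 (t ≡ᵇ x)) ≡ h x
  sumUpTo-𝟙 (suc m) h {zero} _ = begin
    h 0 * 1ℤ + sumUpTo m (λ t → h (suc t) * 0ℤ)
      ≡⟨ cong₂ _+_ (ℤₚ.*-identityʳ (h 0)) (sumUpTo-zero m (ℤₚ.*-zeroʳ ∘ h ∘ ℕ.suc)) ⟩
    h 0 + 0ℤ
      ≡⟨ ℤₚ.+-identityʳ (h 0) ⟩
    h 0 ∎
    where open ≡-Reasoning
  sumUpTo-𝟙 (suc m) h {suc x} (s≤s x<m) =
    trans (cong (_+ sumUpTo m (λ t → h (suc t) * 𝟙 (t ≡ᵇ x))) (ℤₚ.*-zeroʳ (h 0)))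
          (trans (ℤₚ.+-identityˡ _) (sumUpTo-𝟙 m (λ t → h (suc t)) x<m))

  sumUpTo-𝟙-beyond : ∀ m h {x} → m ℕ.≤ x → sumUpTo m (λ t → h t * 𝟙 (t ≡ᵇ x)) ≡ 0ℤ
  sumUpTo-𝟙-beyond zero    h         _         = refl
  sumUpTo-𝟙-beyond (suc m) h {suc x} (s≤s m≤x) =
    trans (cong (_+ sumUpTo m (λ t → h (suc t) * 𝟙 (t ≡ᵇ x))) (ℤₚ.*-zeroʳ (h 0)))
          (trans (ℤₚ.+-identityˡ _) (sumUpTo-𝟙-beyond m (λ t → h (suc t)) m≤x))

  sumList : {A : Set} → (A → ℤ) → List A → ℤ
  sumList F []       = 0ℤ
  sumList F (x ∷ xs) = F x + sumList F xs

  sumList-++ : {A : Set} (F : A → ℤ) → ∀ xs ys → sumList F (xs ++ ys) ≡ sumList F xs + sumList F ys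
  sumList-++ F []       ys = sym (ℤₚ.+-identityˡ _)
  sumList-++ F (x ∷ xs) ys = trans (cong (F x +_) (sumList-++ F xs ys)) (sym (ℤₚ.+-assoc (F x) _ _))

  sumList-concatMap : {A B : Set} (F : B → ℤ) (G : A → List B) → ∀ xs →
                      sumList F (concatMap G xs) ≡ sumList (sumList F ∘ G) xs
  sumList-concatMap F G []       = refl
  sumList-concatMap F G (x ∷ xs) =
    trans (sumList-++ F (G x) (concatMap G xs)) (cong (sumList F (G x) +_) (sumList-concatMap F G xs))

  sumList-map : {A B : Set} (F : B → ℤ) (f : A → B) → ∀ xs → sumList F (map f xs) ≡ sumList (F ∘ f) xs
  sumList-map F f []       = refl
  sumList-map F f (x ∷ xs) = cong (F (f x) +_) (sumList-map F f xs)

  sumList-applyUpTo : {A : Set} (F : A → ℤ) (h : ℕ → A) → ∀ m → sumList F (applyUpTo h m) ≡ sumUpTo m (F ∘ h)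
  sumList-applyUpTo F h zero    = refl
  sumList-applyUpTo F h (suc m) = cong (F (h 0) +_) (sumList-applyUpTo F (λ t → h (suc t)) m)

  sumList-ineqs : ∀ n (F : Ineq → ℤ) → sumList F (ineqs n) ≡
    F cap + (sumUpTo (n ∸ 1) (F ∘ column ∘ ℕ.suc) + (sumUpTo (n ∸ 1) (F ∘ row ∘ ℕ.suc)
      + (sumUpTo (n ∸ 1) (F ∘ triangle ∘ ℕ.suc) + sumUpTo (suc n) (λ k → sumUpTo (k ∸ 2) (λ j → F (square j k))))))
  sumList-ineqs n F = cong (F cap +_)
    (trans (sumList-++ F (map column (mid n)) _) (cong₂ _+_ (sumList-mid column)
    (trans (sumList-++ F (map row (mid n)) _) (cong₂ _+_ (sumList-mid row)
    (trans (sumList-++ F (map triangle (mid n)) _) (cong₂ _+_ (sumList-mid triangle)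
    (trans (sumList-concatMap F (squares n) (upTo (suc n)))
    (trans (sumList-applyUpTo (sumList F ∘ squares n) (λ k → k) (suc n))
           (sumUpTo-cong (suc n) λ k → trans (sumList-map F (λ j → square j k) (upTo (k ∸ 2)))
                                             (sumList-applyUpTo _ (λ j → j) (k ∸ 2)))))))))))
    where
    sumList-mid : ∀ f → sumList F (map f (mid n)) ≡ sumUpTo (n ∸ 1) (F ∘ f ∘ ℕ.suc)
    sumList-mid f = trans (sumList-map F f (mid n))
                   (trans (sumList-map (F ∘ f) suc (upTo (n ∸ 1))) (sumList-applyUpTo _ (λ t → t) (n ∸ 1)))

module LongestPaths (n : ℕ) (g : ℕ → ℕ → ℤ) where

  open import Data.Integer using (ℤ; 0ℤ; _-_; _≤_)
  import Data.Integer.Properties as ℤₚ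
  open IntegerFolds using (maxUpTo; maxUpTo-nonneg; maxUpTo-≥; maxUpTo-mono)

  edge : ℕ → ℕ → ℤ
  edge j k = g j (suc k) - g k (suc k)

  -- longest f k is the heaviest path k < k₁ < ⋯ ≤ n ∸ 1 with at most f steps, a step j → k weighing − edge j k.
  longest : ℕ → ℕ → ℤ
  longest zero    k = 0ℤ
  longest (suc f) k = maxUpTo (n ∸ 1 ∸ k) (λ t → longest f (suc k ℕ.+ t) - edge k (suc k ℕ.+ t))

  dist : ℕ → ℤ
  dist k = longest (n ∸ 1 ∸ k) k

  longest-nonneg : ∀ f k → 0ℤ ≤ longest f k
  longest-nonneg zero    k = ℤₚ.≤-refl
  longest-nonneg (suc f) k = maxUpTo-nonneg (n ∸ 1 ∸ k) _

  longest-mono : ∀ {f f′} k → f ℕ.≤ f′ → longest f k ≤ longest f′ k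
  longest-mono {f′ = f′}   k z≤n       = longest-nonneg f′ k
  longest-mono {suc f} {suc f′} k (s≤s f≤f′) =
    maxUpTo-mono (n ∸ 1 ∸ k) (λ t → ℤₚ.+-monoˡ-≤ _ (longest-mono (suc k ℕ.+ t) f≤f′))

  dist-nonneg : ∀ k → 0ℤ ≤ dist k
  dist-nonneg k = longest-nonneg (n ∸ 1 ∸ k) k

  dist-last : dist (n ∸ 1) ≡ 0ℤ
  dist-last = cong (λ f → longest f (n ∸ 1)) (ℕₚ.n∸n≡0 (n ∸ 1))

  dist-step : ∀ {j k} → j ℕ.< k → k ℕ.≤ n ∸ 1 → dist k - edge j k ≤ dist j
  dist-step {j} {k} j<k k≤n-1 = begin
    longest (n ∸ 1 ∸ k) k - edge j k                         ≤⟨ ℤₚ.+-monoˡ-≤ _ (longest-mono k (ℕₚ.∸-monoʳ-≤ (n ∸ 1) j<k)) ⟩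
    longest f k - edge j k                                   ≡⟨ cong (λ k → longest f k - edge j k) (ℕₚ.m+[n∸m]≡n j<k) ⟨
    longest f (suc j ℕ.+ (k ∸ suc j)) - edge j (suc j ℕ.+ (k ∸ suc j))
                                                             ≤⟨ maxUpTo-≥ (n ∸ 1 ∸ j) _ t<n-1-j ⟩
    longest (suc f) j                                        ≡⟨ cong (λ f → longest f j) n-1-j≡1+f ⟨
    dist j                                                   ∎
    where
    open ℤₚ.≤-Reasoning
    f = n ∸ 1 ∸ suc j
    n-1-j≡1+f : n ∸ 1 ∸ j ≡ suc f
    n-1-j≡1+f = ℕₚ.+-∸-assoc 1 (ℕₚ.≤-trans j<k k≤n-1)
    t<n-1-j : k ∸ suc j ℕ.< n ∸ 1 ∸ j
    t<n-1-j = subst (k ∸ suc j ℕ.<_) (sym n-1-j≡1+f) (s≤s (ℕₚ.∸-monoˡ-≤ (suc j) k≤n-1))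

module DualSolution (n : ℕ) (g : ℕ → ℕ → ℤ) where

  open import Data.Integer using (ℤ; 0ℤ; 1ℤ; _+_; _-_; _*_; -_; _≤_)
  import Data.Integer.Properties as ℤₚ
  open import Data.Integer.Solver using (module +-*-Solver)
  open +-*-Solver
  open Indicators
  open IntegerFolds
  open LongestPaths n g

  y₀ : ℤ
  y₀ = maxUpTo n (λ k → dist k + g k (suc k))

  -- There is no inequality row 0, so α 0 is chosen to make β 0 vanish.
  α : ℕ → ℤ
  α zero    = y₀ - g 0 1
  α (suc k) = dist (suc k)

  β : ℕ → ℤ
  β i = y₀ - g i (suc i) - α i

  γ : ℕ → ℕ → ℤ
  γ j k = g j k - g (k ∸ 1) k + α j - α (k ∸ 1)

  weight : Ineq → ℤ
  weight cap          = y₀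
  weight (column i)   = α (i ∸ 1)
  weight (row i)      = β i
  weight (triangle i) = γ (i ∸ 1) (suc i)
  weight (square j k) = γ j k

  dist≤α : 1 ℕ.≤ n → ∀ k → dist k ≤ α k
  dist≤α 1≤n zero    = ℤₚ.0≤i-j⇒j≤i (ℤₚ.≤-trans (ℤₚ.i≤j⇒0≤j-i (maxUpTo-≥ n _ 1≤n))
                         (ℤₚ.≤-reflexive (solve 3 (λ y d c → y :- (d :+ c) := y :- c :- d) refl y₀ (dist 0) (g 0 1))))
  dist≤α 1≤n (suc k) = ℤₚ.≤-refl

  β-nonneg : ∀ {i} → 1 ℕ.≤ i → i ℕ.< n → 0ℤ ≤ β i
  β-nonneg {suc i} _ i<n = ℤₚ.≤-trans (ℤₚ.i≤j⇒0≤j-i (maxUpTo-≥ n _ i<n))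
    (ℤₚ.≤-reflexive (solve 3 (λ y d c → y :- (d :+ c) := y :- c :- d) refl y₀ (dist (suc i)) (g (suc i) (suc (suc i)))))

  γ-nonneg : ∀ {j k} → 2 ℕ.+ j ℕ.≤ k → k ℕ.≤ n → 0ℤ ≤ γ j k
  γ-nonneg {j} {suc (suc k)} (s≤s (s≤s j≤k)) k≤n = ℤₚ.≤-trans (ℤₚ.i≤j⇒0≤j-i path)
    (ℤₚ.≤-reflexive (solve 4 (λ a d x y → a :- (d :- (x :- y)) := x :- y :+ a :- d) refl
      (α j) (dist (suc k)) (g j (suc (suc k))) (g (suc k) (suc (suc k)))))
    where
    path : dist (suc k) - edge j (suc k) ≤ α j
    path = ℤₚ.≤-trans (dist-step (s≤s j≤k) (ℕₚ.∸-monoˡ-≤ 1 k≤n)) (dist≤α (ℕₚ.≤-trans (s≤s z≤n) k≤n) j)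

  weight-nonneg : 1 ℕ.≤ n → ∀ ℓ → Valid n ℓ → 0ℤ ≤ weight ℓ
  weight-nonneg 1≤n cap                _                = maxUpTo-nonneg n _
  weight-nonneg 1≤n (column i)         _                = ℤₚ.≤-trans (dist-nonneg (i ∸ 1)) (dist≤α 1≤n (i ∸ 1))
  weight-nonneg 1≤n (row i)            (1≤i , i<n)      = β-nonneg 1≤i i<n
  weight-nonneg 1≤n (triangle (suc i)) (_ , i<n)        = γ-nonneg ℕₚ.≤-refl i<n
  weight-nonneg 1≤n (square j k)       (3+j≤k , k≤n)    = γ-nonneg (ℕₚ.≤-trans (ℕₚ.n≤1+n _) 3+j≤k) k≤n

  α-suc : ∀ {k} → 1 ℕ.≤ k → α k ≡ dist k
  α-suc {suc k} _ = refl

  Σcolumns : ℕ → ℤ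
  Σcolumns p = sumUpTo (n ∸ 1) (λ t → α t * - 𝟙 (t ≡ᵇ p))

  Σrows : ℕ → ℤ
  Σrows q = sumUpTo (n ∸ 1) (λ t → β (suc t) * - 𝟙 (suc (suc t) ≡ᵇ q))

  Σtriangles : ℕ → ℕ → ℤ
  Σtriangles p q = sumUpTo (n ∸ 1) (λ t → γ t (suc (suc t)) * 𝟙 ((t ≡ᵇ p) ∧ (q ≡ᵇ suc (suc t))))

  Σsquares : ℕ → ℕ → ℤ
  Σsquares p q = sumUpTo (suc n) (λ k → sumUpTo (k ∸ 2) (λ j → γ j k * 𝟙 ((j ≡ᵇ p) ∧ (k ≡ᵇ q))))

  Σcolumns≡ : 2 ℕ.≤ n → ∀ {p} → p ℕ.< n → Σcolumns p ≡ - α p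
  Σcolumns≡ 2≤n {p} p<n with p ℕ.<? n ∸ 1
  ... | yes p<n-1 = trans (sumUpTo-*-neg (n ∸ 1) α (λ t → 𝟙 (t ≡ᵇ p))) (cong -_ (sumUpTo-𝟙 (n ∸ 1) α p<n-1))
  ... | no  p≮n-1 = begin
    Σcolumns p            ≡⟨ sumUpTo-*-neg (n ∸ 1) α (λ t → 𝟙 (t ≡ᵇ p)) ⟩
    - sumUpTo (n ∸ 1) _   ≡⟨ cong -_ (sumUpTo-𝟙-beyond (n ∸ 1) α (ℕₚ.≮⇒≥ p≮n-1)) ⟩
    - 0ℤ                  ≡⟨ cong -_ (trans (sym dist-last) (sym (α-suc (ℕₚ.∸-monoˡ-≤ 1 2≤n)))) ⟩
    - α (n ∸ 1)           ≡⟨ cong (-_ ∘ α) p≡n-1 ⟨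
    - α p                 ∎
    where
    open ≡-Reasoning
    p≡n-1 : p ≡ n ∸ 1
    p≡n-1 = ℕₚ.≤-antisym (ℕₚ.∸-monoˡ-≤ 1 p<n) (ℕₚ.≮⇒≥ p≮n-1)

  Σrows≡ : ∀ {q} → 1 ℕ.≤ q → q ℕ.≤ n → Σrows q ≡ - β (q ∸ 1)
  Σrows≡ {suc zero}    _ _   = trans (sumUpTo-zero (n ∸ 1) (λ t → ℤₚ.*-zeroʳ (β (suc t))))
                                     (cong -_ (solve 2 (λ y c → con 0ℤ := y :- c :- (y :- c)) refl y₀ (g 0 1)))
  Σrows≡ {suc (suc q)} _ q≤n = trans (sumUpTo-*-neg (n ∸ 1) (β ∘ ℕ.suc) (λ t → 𝟙 (t ≡ᵇ q)))
                                     (cong -_ (sumUpTo-𝟙 (n ∸ 1) (β ∘ ℕ.suc) (ℕₚ.∸-monoˡ-≤ 1 q≤n)))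

  triangle-term : ∀ p q t → γ t (suc (suc t)) * 𝟙 ((t ≡ᵇ p) ∧ (q ≡ᵇ suc (suc t)))
                          ≡ γ t (suc (suc t)) * 𝟙 (q ≡ᵇ suc (suc p)) * 𝟙 (t ≡ᵇ p)
  triangle-term p q t with t ≡ᵇ p in t≡ᵇp
  ... | false = trans (ℤₚ.*-zeroʳ (γ t (suc (suc t)))) (sym (ℤₚ.*-zeroʳ (γ t (suc (suc t)) * 𝟙 (q ≡ᵇ suc (suc p)))))
  ... | true rewrite ℕₚ.≡ᵇ⇒≡ t p (Equivalence.from T-≡ t≡ᵇp) =
    sym (ℤₚ.*-identityʳ (γ p (suc (suc p)) * 𝟙 (q ≡ᵇ suc (suc p))))

  Σtriangles≡ : ∀ {p q} → q ℕ.≤ n → Σtriangles p q ≡ γ p (suc (suc p)) * 𝟙 (q ≡ᵇ suc (suc p))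
  Σtriangles≡ {p} {q} q≤n with p ℕ.<? n ∸ 1
  ... | yes p<n-1 = trans (sumUpTo-cong (n ∸ 1) (triangle-term p q))
                          (sumUpTo-𝟙 (n ∸ 1) (λ t → γ t (suc (suc t)) * 𝟙 (q ≡ᵇ suc (suc p))) p<n-1)
  ... | no  p≮n-1 = begin
    Σtriangles p q                           ≡⟨ sumUpTo-cong (n ∸ 1) (triangle-term p q) ⟩
    sumUpTo (n ∸ 1) _
      ≡⟨ sumUpTo-𝟙-beyond (n ∸ 1) (λ t → γ t (suc (suc t)) * 𝟙 (q ≡ᵇ suc (suc p))) (ℕₚ.≮⇒≥ p≮n-1) ⟩
    0ℤ                                       ≡⟨ ℤₚ.*-zeroʳ (γ p (suc (suc p))) ⟨
    γ p (suc (suc p)) * 0ℤ                   ≡⟨ cong (λ b → γ p (suc (suc p)) * 𝟙 b) (≢⇒≡ᵇ-false q≢2+p) ⟨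
    γ p (suc (suc p)) * 𝟙 (q ≡ᵇ suc (suc p)) ∎
    where
    open ≡-Reasoning
    q≢2+p : q ≢ suc (suc p)
    q≢2+p refl = p≮n-1 (ℕₚ.∸-monoˡ-≤ 1 q≤n)

  Σsquares≡ : ∀ {p q} → q ℕ.≤ n → Σsquares p q ≡ sumUpTo (q ∸ 2) (λ j → γ j q * 𝟙 (j ≡ᵇ p))
  Σsquares≡ {p} {q} q≤n = trans (sumUpTo-cong (suc n) factor)
                                (sumUpTo-𝟙 (suc n) (λ k → sumUpTo (k ∸ 2) (λ j → γ j k * 𝟙 (j ≡ᵇ p))) (s≤s q≤n))
    where
    factor : ∀ k → sumUpTo (k ∸ 2) (λ j → γ j k * 𝟙 ((j ≡ᵇ p) ∧ (k ≡ᵇ q)))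
                 ≡ sumUpTo (k ∸ 2) (λ j → γ j k * 𝟙 (j ≡ᵇ p)) * 𝟙 (k ≡ᵇ q)
    factor k = trans (sumUpTo-cong (k ∸ 2) λ j → trans (cong (γ j k *_) (𝟙-∧ (j ≡ᵇ p) (k ≡ᵇ q)))
                                                        (sym (ℤₚ.*-assoc (γ j k) _ _)))
                     (sumUpTo-*ʳ (k ∸ 2) _ (𝟙 (k ≡ᵇ q)))

  Σcorners≡ : ∀ {p q} → p ℕ.< q → q ℕ.≤ n → Σtriangles p q + Σsquares p q ≡ γ p q
  Σcorners≡ {p} {q} p<q q≤n
    rewrite Σtriangles≡ {p} q≤n | Σsquares≡ {p} q≤n with q ∸ suc p | ℕₚ.m∸n+n≡m p<q
  ... | zero | refl = begin
    γ p (suc (suc p)) * 𝟙 (p ≡ᵇ suc p) + sumUpTo (p ∸ 1) _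
        ≡⟨ cong₂ _+_ (cong (λ b → γ p (suc (suc p)) * 𝟙 b) (≢⇒≡ᵇ-false (ℕₚ.<⇒≢ (ℕₚ.n<1+n p))))
                     (sumUpTo-𝟙-beyond (p ∸ 1) (λ j → γ j (suc p)) (ℕₚ.m∸n≤m p 1)) ⟩
    γ p (suc (suc p)) * 0ℤ + 0ℤ
        ≡⟨ trans (ℤₚ.+-identityʳ _) (ℤₚ.*-zeroʳ (γ p (suc (suc p)))) ⟩
    0ℤ
        ≡⟨ solve 2 (λ x a → con 0ℤ := x :- x :+ a :- a) refl (g p (suc p)) (α p) ⟩
    γ p (suc p) ∎
    where open ≡-Reasoning
  ... | suc zero | refl = begin
    γ p (suc (suc p)) * 𝟙 (p ≡ᵇ p) + sumUpTo p _
        ≡⟨ cong₂ _+_ (cong (λ b → γ p (suc (suc p)) * 𝟙 b) (≡ᵇ-refl p))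
                     (sumUpTo-𝟙-beyond p (λ j → γ j (suc (suc p))) ℕₚ.≤-refl) ⟩
    γ p (suc (suc p)) * 1ℤ + 0ℤ
        ≡⟨ trans (ℤₚ.+-identityʳ _) (ℤₚ.*-identityʳ (γ p (suc (suc p)))) ⟩
    γ p (suc (suc p)) ∎
    where open ≡-Reasoning
  ... | suc (suc d) | refl = begin
    γ p (suc (suc p)) * 𝟙 (d ℕ.+ suc p ≡ᵇ p) + sumUpTo (d ℕ.+ suc p) _
        ≡⟨ cong₂ _+_ (cong (λ b → γ p (suc (suc p)) * 𝟙 b) (≢⇒≡ᵇ-false (ℕₚ.>⇒≢ p<d+1+p)))
                     (sumUpTo-𝟙 (d ℕ.+ suc p) (λ j → γ j q′) p<d+1+p) ⟩
    γ p (suc (suc p)) * 0ℤ + γ p q′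
        ≡⟨ trans (cong (_+ γ p q′) (ℤₚ.*-zeroʳ (γ p (suc (suc p))))) (ℤₚ.+-identityˡ (γ p q′)) ⟩
    γ p q′ ∎
    where
    open ≡-Reasoning
    q′ = suc (suc (d ℕ.+ suc p))
    p<d+1+p : p ℕ.< d ℕ.+ suc p
    p<d+1+p = ℕₚ.m≤n+m (suc p) d

  weight-rectValue : 2 ℕ.≤ n → ∀ {p q} → p ℕ.< q → q ℕ.≤ n →
                     sumList (λ ℓ → weight ℓ * rectValue ℓ p q) (ineqs n) ≡ g p q
  weight-rectValue 2≤n {p} {suc q} p<q q≤n = begin
    sumList (λ ℓ → weight ℓ * rectValue ℓ p (suc q)) (ineqs n)
        ≡⟨ sumList-ineqs n (λ ℓ → weight ℓ * rectValue ℓ p (suc q)) ⟩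
    y₀ * 1ℤ + (Σcolumns p + (Σrows (suc q) + (Σtriangles p (suc q) + Σsquares p (suc q))))
        ≡⟨ cong (λ s → y₀ * 1ℤ + s) (cong₂ _+_ (Σcolumns≡ 2≤n (ℕₚ.<-≤-trans p<q q≤n))
                                       (cong₂ _+_ (Σrows≡ (s≤s z≤n) q≤n) (Σcorners≡ p<q q≤n))) ⟩
    y₀ * 1ℤ + (- α p + (- β q + γ p (suc q)))
        ≡⟨ solve 5 (λ y a a′ c c′ → y :* con 1ℤ :+ (:- a :+ (:- (y :- c′ :- a′) :+ (c :- c′ :+ a :- a′))) := c)
                   refl y₀ (α p) (α q) (g p (suc q)) (g q (suc q)) ⟩
    g p (suc q) ∎
    where open ≡-Reasoning

  weight-cap : sumList (λ ℓ → weight ℓ * δ cap ℓ) (ineqs n) ≡ y₀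
  weight-cap = begin
    sumList (λ ℓ → weight ℓ * δ cap ℓ) (ineqs n)
      ≡⟨ sumList-ineqs n (λ ℓ → weight ℓ * δ cap ℓ) ⟩
    y₀ * 1ℤ + (sumUpTo (n ∸ 1) (λ t → α t * 0ℤ) + _)
      ≡⟨ cong (y₀ * 1ℤ +_) (cong₂ _+_ (zeros (n ∸ 1) α) (cong₂ _+_ (zeros (n ∸ 1) (β ∘ ℕ.suc))
           (cong₂ _+_ (zeros (n ∸ 1) (λ t → γ t (suc (suc t)))) (sumUpTo-zero (suc n) (λ k → zeros (k ∸ 2) (λ j → γ j k)))))) ⟩
    y₀ * 1ℤ + (0ℤ + (0ℤ + (0ℤ + 0ℤ)))
      ≡⟨ trans (ℤₚ.+-identityʳ (y₀ * 1ℤ)) (ℤₚ.*-identityʳ y₀) ⟩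
    y₀ ∎
    where
    open ≡-Reasoning
    zeros : ∀ m (h : ℕ → ℤ) → sumUpTo m (λ t → h t * 0ℤ) ≡ 0ℤ
    zeros m h = sumUpTo-zero m (λ t → ℤₚ.*-zeroʳ (h t))

-- Linear algebra over ℚ

import Data.Integer as ℤ
import Data.Integer.Properties as ℤₚ
open import Data.Rational as ℚ using (ℚ; _+_; _-_; _*_; -_; _≤_; toℚᵘ)
import Data.Rational.Properties as ℚₚ
open import Data.Rational.Unnormalised as ℚᵘ using (mkℚᵘ; *≡*; *≤*)
import Data.Rational.Unnormalised.Properties as ℚᵘₚ
open import Data.Rational.Solver using (module +-*-Solver)
open import Algebra.Bundles using (CommutativeRing)
import Algebra.Properties.Semiring.Sum as Sum
module ℤΣ = Sum ℤₚ.+-*-semiring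
open Sum (CommutativeRing.semiring ℚₚ.+-*-commutativeRing)
  using (sum; sum-cong-≗; sum-replicate-zero; ∑-distrib-+; ∑-comm; *-distribˡ-sum)
open Indicators using (𝟙; inRect; rectValue; inRect-corner; inRect-corner₀; inRect-cap; inRect-column; inRect-row;
                       inRect-triangle; inRect-square)
open IntegerFolds using (sumList)

toℚᵘ-ℤ→ℚ : ∀ z → toℚᵘ (ℤ→ℚ z) ℚᵘ.≃ mkℚᵘ z 0
toℚᵘ-ℤ→ℚ z = ℚₚ.toℚᵘ-fromℚᵘ (mkℚᵘ z 0)

ℤ→ℚ-homo-+ : ∀ a b → ℤ→ℚ (a ℤ.+ b) ≡ ℤ→ℚ a + ℤ→ℚ b
ℤ→ℚ-homo-+ a b = ℚₚ.toℚᵘ-injective (begin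
  toℚᵘ (ℤ→ℚ (a ℤ.+ b))                 ≈⟨ toℚᵘ-ℤ→ℚ (a ℤ.+ b) ⟩
  mkℚᵘ (a ℤ.+ b) 0                     ≈⟨ *≡* (cong (ℤ._* ℤ.1ℤ) (sym (cong₂ ℤ._+_ (ℤₚ.*-identityʳ a) (ℤₚ.*-identityʳ b)))) ⟩
  mkℚᵘ a 0 ℚᵘ.+ mkℚᵘ b 0               ≈⟨ ℚᵘₚ.+-cong (toℚᵘ-ℤ→ℚ a) (toℚᵘ-ℤ→ℚ b) ⟨
  toℚᵘ (ℤ→ℚ a) ℚᵘ.+ toℚᵘ (ℤ→ℚ b)       ≈⟨ ℚₚ.toℚᵘ-homo-+ (ℤ→ℚ a) (ℤ→ℚ b) ⟨
  toℚᵘ (ℤ→ℚ a + ℤ→ℚ b)                 ∎)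
  where open ℚᵘₚ.≃-Reasoning

ℤ→ℚ-homo-* : ∀ a b → ℤ→ℚ (a ℤ.* b) ≡ ℤ→ℚ a * ℤ→ℚ b
ℤ→ℚ-homo-* a b = ℚₚ.toℚᵘ-injective (begin
  toℚᵘ (ℤ→ℚ (a ℤ.* b))                 ≈⟨ toℚᵘ-ℤ→ℚ (a ℤ.* b) ⟩
  mkℚᵘ (a ℤ.* b) 0                     ≈⟨ ℚᵘₚ.*-cong (toℚᵘ-ℤ→ℚ a) (toℚᵘ-ℤ→ℚ b) ⟨
  toℚᵘ (ℤ→ℚ a) ℚᵘ.* toℚᵘ (ℤ→ℚ b)       ≈⟨ ℚₚ.toℚᵘ-homo-* (ℤ→ℚ a) (ℤ→ℚ b) ⟨
  toℚᵘ (ℤ→ℚ a * ℤ→ℚ b)                 ∎)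
  where open ℚᵘₚ.≃-Reasoning

ℤ→ℚ-homo‿- : ∀ a → ℤ→ℚ (ℤ.- a) ≡ - ℤ→ℚ a
ℤ→ℚ-homo‿- a = ℚₚ.toℚᵘ-injective (begin
  toℚᵘ (ℤ→ℚ (ℤ.- a))                   ≈⟨ toℚᵘ-ℤ→ℚ (ℤ.- a) ⟩
  mkℚᵘ (ℤ.- a) 0                       ≈⟨ ℚᵘₚ.-‿cong (toℚᵘ-ℤ→ℚ a) ⟨
  ℚᵘ.- toℚᵘ (ℤ→ℚ a)                    ≈⟨ ℚₚ.toℚᵘ-homo‿- (ℤ→ℚ a) ⟨
  toℚᵘ (- ℤ→ℚ a)                       ∎)
  where open ℚᵘₚ.≃-Reasoning

ℤ→ℚ-homo-minus : ∀ a b → ℤ→ℚ (a ℤ.- b) ≡ ℤ→ℚ a - ℤ→ℚ b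
ℤ→ℚ-homo-minus a b = trans (ℤ→ℚ-homo-+ a (ℤ.- b)) (cong (ℤ→ℚ a +_) (ℤ→ℚ-homo‿- b))

ℤ→ℚ-mono-≤ : ∀ {a b} → a ℤ.≤ b → ℤ→ℚ a ≤ ℤ→ℚ b
ℤ→ℚ-mono-≤ {a} {b} a≤b = ℚₚ.toℚᵘ-cancel-≤ (ℚᵘₚ.≤-respʳ-≃ (ℚᵘₚ.≃-sym (toℚᵘ-ℤ→ℚ b))
  (ℚᵘₚ.≤-respˡ-≃ (ℚᵘₚ.≃-sym (toℚᵘ-ℤ→ℚ a)) (*≤* (ℤₚ.*-monoʳ-≤-nonNeg ℤ.1ℤ a≤b))))

sumFin≡sum : ∀ {m} (f : Fin m → ℚ) → sumFin f ≡ sum f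
sumFin≡sum {zero}  f = refl
sumFin≡sum {suc m} f = cong (f zero +_) (sumFin≡sum (λ i → f (suc i)))

sumFin-cong : ∀ {m} {f g : Fin m → ℚ} → (∀ i → f i ≡ g i) → sumFin f ≡ sumFin g
sumFin-cong {f = f} {g} f≗g rewrite sumFin≡sum f | sumFin≡sum g = sum-cong-≗ f≗g

sumFin-zero : ∀ {m} {f : Fin m → ℚ} → (∀ i → f i ≡ 0ℚ) → sumFin f ≡ 0ℚ
sumFin-zero {m} f≗0 = trans (sumFin-cong f≗0) (trans (sumFin≡sum {m} (λ _ → 0ℚ)) (sum-replicate-zero m))

sumFin-distrib-+ : ∀ {m} (f g : Fin m → ℚ) → sumFin (λ i → f i + g i) ≡ sumFin f + sumFin g
sumFin-distrib-+ f g rewrite sumFin≡sum (λ i → f i + g i) | sumFin≡sum f | sumFin≡sum g = ∑-distrib-+ f g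

sumFin-*ˡ : ∀ {m} x (f : Fin m → ℚ) → sumFin (λ i → x * f i) ≡ x * sumFin f
sumFin-*ˡ x f rewrite sumFin≡sum (λ i → x * f i) | sumFin≡sum f = sym (*-distribˡ-sum x f)

sumFin-comm : ∀ {k m} (h : Fin k → Fin m → ℚ) →
              sumFin (λ i → sumFin (h i)) ≡ sumFin (λ j → sumFin (λ i → h i j))
sumFin-comm h = begin
  sumFin (λ i → sumFin (h i))                ≡⟨ sumFin-cong (λ i → sumFin≡sum (h i)) ⟩
  sumFin (λ i → sum (h i))                   ≡⟨ sumFin≡sum (λ i → sum (h i)) ⟩
  sum (λ i → sum (h i))                      ≡⟨ ∑-comm h ⟩
  sum (λ j → sum (λ i → h i j))              ≡⟨ sumFin≡sum (λ j → sum (λ i → h i j)) ⟨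
  sumFin (λ j → sum (λ i → h i j))           ≡⟨ sumFin-cong (λ j → sumFin≡sum (λ i → h i j)) ⟨
  sumFin (λ j → sumFin (λ i → h i j))        ∎
  where open ≡-Reasoning

sumFin-neg : ∀ {m} (f : Fin m → ℚ) → sumFin (λ i → - f i) ≡ - sumFin f
sumFin-neg {zero}  f = refl
sumFin-neg {suc m} f = trans (cong (- f zero +_) (sumFin-neg (λ i → f (suc i)))) (sym (ℚₚ.neg-distrib-+ (f zero) _))

sumFin-distrib-minus : ∀ {m} (f g : Fin m → ℚ) → sumFin (λ i → f i - g i) ≡ sumFin f - sumFin g
sumFin-distrib-minus f g = trans (sumFin-distrib-+ f (λ i → - g i)) (cong (sumFin f +_) (sumFin-neg g))

sumFin-nonneg : ∀ {m} {f : Fin m → ℚ} → (∀ i → 0ℚ ≤ f i) → 0ℚ ≤ sumFin f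
sumFin-nonneg {zero}  f≥0 = ℚₚ.≤-refl
sumFin-nonneg {suc m} f≥0 = ℚₚ.≤-trans (ℚₚ.≤-reflexive (sym (ℚₚ.+-identityʳ 0ℚ)))
                                      (ℚₚ.+-mono-≤ (f≥0 zero) (sumFin-nonneg (f≥0 ∘ suc)))

sumFin-origin : ∀ {A B : Set} (f : A → B) (G : A → ℤ) {ys} xs (ys≡ : ys ≡ map f xs) →
                sumFin (λ i → ℤ→ℚ (G (origin f xs ys≡ i))) ≡ ℤ→ℚ (sumList G xs)
sumFin-origin f G []       refl = refl
sumFin-origin f G (x ∷ xs) refl =
  trans (cong (ℤ→ℚ (G x) +_) (sumFin-origin f G xs refl)) (sym (ℤ→ℚ-homo-+ (G x) (sumList G xs)))

ℤ→ℚ-sum : ∀ {m} (f : Fin m → ℤ) → ℤ→ℚ (ℤΣ.sum f) ≡ sumFin (λ i → ℤ→ℚ (f i))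
ℤ→ℚ-sum {zero}  f = refl
ℤ→ℚ-sum {suc m} f = trans (ℤ→ℚ-homo-+ (f zero) (ℤΣ.sum (λ i → f (suc i))))
                          (cong (ℤ→ℚ (f zero) +_) (ℤ→ℚ-sum (λ i → f (suc i))))

dot-congˡ : ∀ {m} {u v : Fin m → ℚ} (x : Fin m → ℚ) → (∀ i → u i ≡ v i) → dot u x ≡ dot v x
dot-congˡ x u≗v = sumFin-cong (λ i → cong (_* x i) (u≗v i))

dot-congʳ : ∀ {m} (u : Fin m → ℚ) {x y : Fin m → ℚ} → (∀ i → x i ≡ y i) → dot u x ≡ dot u y
dot-congʳ u x≗y = sumFin-cong (λ i → cong (u i *_) (x≗y i))

dot-zeroʳ : ∀ {m} (u : Fin m → ℚ) {x : Fin m → ℚ} → (∀ i → x i ≡ 0ℚ) → dot u x ≡ 0ℚ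
dot-zeroʳ u x≗0 = sumFin-zero (λ i → trans (cong (u i *_) (x≗0 i)) (ℚₚ.*-zeroʳ (u i)))

dot-⊕ˡ : ∀ {m} (u v x : Fin m → ℚ) → dot (u ⊕ v) x ≡ dot u x + dot v x
dot-⊕ˡ u v x = trans (sumFin-cong (λ i → ℚₚ.*-distribʳ-+ (x i) (u i) (v i)))
                    (sumFin-distrib-+ (λ i → u i * x i) (λ i → v i * x i))

dot-⊖ˡ : ∀ {m} (u v x : Fin m → ℚ) → dot (u ⊖ v) x ≡ dot u x - dot v x
dot-⊖ˡ u v x = trans (sumFin-cong (λ i → solve 3 (λ a b c → (a :- b) :* c := a :* c :- b :* c) refl (u i) (v i) (x i)))
                    (sumFin-distrib-minus (λ i → u i * x i) (λ i → v i * x i))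
  where open +-*-Solver

dot-⊖ʳ : ∀ {m} (u x y : Fin m → ℚ) → dot u (x ⊖ y) ≡ dot u x - dot u y
dot-⊖ʳ u x y = trans (sumFin-cong (λ i → solve 3 (λ a b c → a :* (b :- c) := a :* b :- a :* c) refl (u i) (x i) (y i)))
                    (sumFin-distrib-minus (λ i → u i * x i) (λ i → u i * y i))
  where open +-*-Solver

dot-transpose : ∀ {k m} (A : Fin k → Fin m → ℚ) (y : Fin k → ℚ) (x : Fin m → ℚ) →
                dot (λ j → sumFin (λ i → A i j * y i)) x ≡ sumFin (λ i → y i * dot (A i) x)
dot-transpose A y x = begin
  sumFin (λ j → sumFin (λ i → A i j * y i) * x j)
    ≡⟨ sumFin-cong (λ j → trans (ℚₚ.*-comm _ (x j)) (sym (sumFin-*ˡ (x j) (λ i → A i j * y i)))) ⟩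
  sumFin (λ j → sumFin (λ i → x j * (A i j * y i)))
    ≡⟨ sumFin-comm (λ j i → x j * (A i j * y i)) ⟩
  sumFin (λ i → sumFin (λ j → x j * (A i j * y i)))
    ≡⟨ sumFin-cong (λ i → trans (sumFin-cong (λ j → rearrange (x j) (A i j) (y i)))
                                (sumFin-*ˡ (y i) (λ j → A i j * x j))) ⟩
  sumFin (λ i → y i * dot (A i) x)
    ∎
  where
  open ≡-Reasoning
  open +-*-Solver
  rearrange : ∀ a b c → a * (b * c) ≡ c * (b * a)
  rearrange = solve 3 (λ a b c → a :* (b :* c) := c :* (b :* a)) refl

if-1-0≡𝟙 : ∀ b → (if b then 1ℚ else 0ℚ) ≡ ℤ→ℚ (𝟙 b)
if-1-0≡𝟙 true  = refl
if-1-0≡𝟙 false = refl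

sumFin-pick : ∀ {m} (x : Fin m → ℚ) a (a<m : a ℕ.< m) →
           sumFin (λ i → (if toℕ i ≡ᵇ a then 1ℚ else 0ℚ) * x i) ≡ x (fromℕ< a<m)
sumFin-pick {suc m} x zero    _ = begin
  1ℚ * x zero + sumFin (λ i → 0ℚ * x (suc i)) ≡⟨ cong (1ℚ * x zero +_) (sumFin-zero (λ i → ℚₚ.*-zeroˡ (x (suc i)))) ⟩
  1ℚ * x zero + 0ℚ                            ≡⟨ trans (ℚₚ.+-identityʳ _) (ℚₚ.*-identityˡ (x zero)) ⟩
  x zero                                      ∎
  where open ≡-Reasoning
sumFin-pick {suc m} x (suc a) (s≤s a<m) =
  trans (cong (_+ sumFin (λ i → (if toℕ i ≡ᵇ a then 1ℚ else 0ℚ) * x (suc i))) (ℚₚ.*-zeroˡ (x zero)))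
        (trans (ℚₚ.+-identityˡ _) (sumFin-pick (λ i → x (suc i)) a a<m))

basis : ∀ {m} → Fin m → Fin m → ℚ
basis idx idx′ = if toℕ idx′ ≡ᵇ toℕ idx then 1ℚ else 0ℚ

dot-basis : ∀ {m} (u : Fin m → ℚ) idx → dot u (basis idx) ≡ u idx
dot-basis u idx = begin
  sumFin (λ i → u i * basis idx i)   ≡⟨ sumFin-cong (λ i → ℚₚ.*-comm (u i) (basis idx i)) ⟩
  sumFin (λ i → basis idx i * u i)   ≡⟨ sumFin-pick u (toℕ idx) (Finₚ.toℕ<n idx) ⟩
  u (fromℕ< (Finₚ.toℕ<n idx))        ≡⟨ cong u (Finₚ.fromℕ<-toℕ idx (Finₚ.toℕ<n idx)) ⟩
  u idx                              ∎
  where open ≡-Reasoning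

-- Rectangle vectors

module _ {m} (u w : Fin m → ℚ) where

  Agree : (Fin m → ℚ) → Set
  Agree x = dot u x ≡ dot w x

  agree-⊖ : ∀ {x y} → Agree x → Agree y → Agree (x ⊖ y)
  agree-⊖ {x} {y} ux≡wx uy≡wy = trans (dot-⊖ʳ u x y) (trans (cong₂ _-_ ux≡wx uy≡wy) (sym (dot-⊖ʳ w x y)))

  agree-≗ : ∀ {x y} → (∀ i → x i ≡ y i) → Agree x → Agree y
  agree-≗ {x} {y} x≗y ux≡wx = trans (dot-congʳ u (sym ∘ x≗y)) (trans ux≡wx (dot-congʳ w x≗y))

module _ (n : ℕ) where

  lo hi : Fin (numVars n) → ℕ
  lo idx = proj₁ (decode (toℕ idx))
  hi idx = proj₂ (decode (toℕ idx))

  lo<hi : (idx : Fin (numVars n)) → lo idx ℕ.< hi idx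
  lo<hi idx = proj₁ (decode-codes (toℕ idx))

  hi≤n : (idx : Fin (numVars n)) → hi idx ℕ.≤ n
  hi≤n idx = decode-bound n (toℕ idx) (subst (toℕ idx ℕ.<_) (numVars≡tri n) (Finₚ.toℕ<n idx))

  tri-hi+lo : (idx : Fin (numVars n)) → tri (hi idx) ℕ.+ lo idx ≡ toℕ idx
  tri-hi+lo idx = proj₂ (decode-codes (toℕ idx))

  rect : (p q : ℕ) → Vec' n
  rect p q idx = ℤ→ℚ (inRect p q (lo idx) (hi idx))

  dot-unit-rect : ∀ {a b} → a ℕ.< b → b ℕ.≤ n → ∀ p q → dot (unit n a b) (rect p q) ≡ ℤ→ℚ (inRect p q a b)
  dot-unit-rect {a} {b} a<b b≤n p q = begin
    dot (unit n a b) (rect p q)         ≡⟨ sumFin-pick (rect p q) (code a b) (code<numVars {n} a<b b≤n) ⟩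
    ℤ→ℚ (inRect p q (lo idx) (hi idx))  ≡⟨ cong (λ d → ℤ→ℚ (inRect p q (proj₁ d) (proj₂ d))) decode-idx ⟩
    ℤ→ℚ (inRect p q a b)                ∎
    where
    open ≡-Reasoning
    idx = fromℕ< (code<numVars {n} a<b b≤n)
    decode-idx : decode (toℕ idx) ≡ (a , b)
    decode-idx = trans (cong decode (trans (Finₚ.toℕ-fromℕ< (code<numVars {n} a<b b≤n)) (code≡tri+ a<b)))
                       (decode-tri+ a<b)

  basis≡𝟙 : (idx idx′ : Fin (numVars n)) →
            basis idx idx′ ≡ ℤ→ℚ (𝟙 ((lo idx′ ≡ᵇ lo idx) ∧ (hi idx′ ≡ᵇ hi idx)))
  basis≡𝟙 idx idx′ = trans (if-1-0≡𝟙 _) (cong (ℤ→ℚ ∘ 𝟙) (begin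
    toℕ idx′ ≡ᵇ toℕ idx                                            ≡⟨ cong₂ _≡ᵇ_ (tri-hi+lo idx′) (tri-hi+lo idx) ⟨
    tri (hi idx′) ℕ.+ lo idx′ ≡ᵇ tri (hi idx) ℕ.+ lo idx           ≡⟨ ≡ᵇ-tri+ (lo<hi idx′) (lo<hi idx) ⟩
    (lo idx′ ≡ᵇ lo idx) ∧ (hi idx′ ≡ᵇ hi idx)                      ∎))
    where open ≡-Reasoning

  basis-rects : ∀ (idx : Fin (numVars n)) {i} → lo idx ≡ suc i → ∀ idx′ →
    basis idx idx′ ≡ ((rect (suc i) (hi idx) ⊖ rect (suc i) (suc (hi idx)))
                       ⊖ (rect i (hi idx) ⊖ rect i (suc (hi idx)))) idx′
  basis-rects idx {i} lo≡1+i idx′ = begin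
    basis idx idx′                                                    ≡⟨ basis≡𝟙 idx idx′ ⟩
    ℤ→ℚ (𝟙 ((a ≡ᵇ lo idx) ∧ (b ≡ᵇ j)))                               ≡⟨ cong (λ l → ℤ→ℚ (𝟙 ((a ≡ᵇ l) ∧ (b ≡ᵇ j)))) lo≡1+i ⟩
    ℤ→ℚ (𝟙 ((a ≡ᵇ suc i) ∧ (b ≡ᵇ j)))                                ≡⟨ cong ℤ→ℚ (inRect-corner i j a b) ⟨
    ℤ→ℚ ((inRect (suc i) j a b ℤ.- inRect (suc i) (suc j) a b) ℤ.- (inRect i j a b ℤ.- inRect i (suc j) a b))
      ≡⟨ trans (ℤ→ℚ-homo-minus (inRect (suc i) j a b ℤ.- inRect (suc i) (suc j) a b)
                               (inRect i j a b ℤ.- inRect i (suc j) a b))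
               (cong₂ _-_ (ℤ→ℚ-homo-minus (inRect (suc i) j a b) (inRect (suc i) (suc j) a b))
                          (ℤ→ℚ-homo-minus (inRect i j a b) (inRect i (suc j) a b))) ⟩
    _ ∎
    where
    open ≡-Reasoning
    a = lo idx′
    b = hi idx′
    j = hi idx

  basis-rects₀ : (idx : Fin (numVars n)) → lo idx ≡ 0 → ∀ idx′ →
    basis idx idx′ ≡ (rect 0 (hi idx) ⊖ rect 0 (suc (hi idx))) idx′
  basis-rects₀ idx lo≡0 idx′ = begin
    basis idx idx′                                       ≡⟨ basis≡𝟙 idx idx′ ⟩
    ℤ→ℚ (𝟙 ((a ≡ᵇ lo idx) ∧ (b ≡ᵇ j)))                  ≡⟨ cong (λ l → ℤ→ℚ (𝟙 ((a ≡ᵇ l) ∧ (b ≡ᵇ j)))) lo≡0 ⟩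
    ℤ→ℚ (𝟙 ((a ≡ᵇ 0) ∧ (b ≡ᵇ j)))                       ≡⟨ cong ℤ→ℚ (inRect-corner₀ j a b) ⟨
    ℤ→ℚ (inRect 0 j a b ℤ.- inRect 0 (suc j) a b)       ≡⟨ ℤ→ℚ-homo-minus (inRect 0 j a b) (inRect 0 (suc j) a b) ⟩
    _ ∎
    where
    open ≡-Reasoning
    a = lo idx′
    b = hi idx′
    j = hi idx

  rect-beyond : ∀ p idx → rect p (suc n) idx ≡ 0ℚ
  rect-beyond p idx = cong ℤ→ℚ (trans (cong (λ b → 𝟙 (lo idx ≤ᵇ p) ℤ.* 𝟙 b) (≤⇒<ᵇ-false (hi≤n idx)))
                                      (ℤₚ.*-zeroʳ (𝟙 (lo idx ≤ᵇ p))))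

  rects-determine : ∀ (u w : Vec' n) → (∀ {p q} → p ℕ.< q → q ℕ.≤ n → Agree u w (rect p q)) →
                    ∀ idx → u idx ≡ w idx
  rects-determine u w agree idx = begin
    u idx              ≡⟨ dot-basis u idx ⟨
    dot u (basis idx)  ≡⟨ agree-basis (lo idx) refl ⟩
    dot w (basis idx)  ≡⟨ dot-basis w idx ⟩
    w idx              ∎
    where
    open ≡-Reasoning
    j = hi idx
    j≤1+n : j ℕ.≤ suc n
    j≤1+n = ℕₚ.m≤n⇒m≤1+n (hi≤n idx)
    agree′ : ∀ {p q} → p ℕ.< q → q ℕ.≤ suc n → Agree u w (rect p q)
    agree′ p<q q≤1+n with ℕₚ.m≤n⇒m<n∨m≡n q≤1+n
    ... | inj₁ q<1+n = agree p<q (ℕₚ.≤-pred q<1+n)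
    ... | inj₂ refl  = trans (dot-zeroʳ u (rect-beyond _)) (sym (dot-zeroʳ w (rect-beyond _)))
    agree-basis : ∀ i → lo idx ≡ i → Agree u w (basis idx)
    agree-basis zero lo≡0 = agree-≗ u w (sym ∘ basis-rects₀ idx lo≡0)
      (agree-⊖ u w (agree′ 0<j j≤1+n) (agree′ (ℕₚ.m<n⇒m<1+n 0<j) (s≤s (hi≤n idx))))
      where
      0<j : 0 ℕ.< j
      0<j = subst (ℕ._< j) lo≡0 (lo<hi idx)
    agree-basis (suc i) lo≡1+i = agree-≗ u w (sym ∘ basis-rects idx lo≡1+i)
      (agree-⊖ u w (agree-⊖ u w (agree′ 1+i<j j≤1+n) (agree′ (ℕₚ.m<n⇒m<1+n 1+i<j) (s≤s (hi≤n idx))))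
                   (agree-⊖ u w (agree′ i<j j≤1+n) (agree′ (ℕₚ.m<n⇒m<1+n i<j) (s≤s (hi≤n idx)))))
      where
      1+i<j : suc i ℕ.< j
      1+i<j = subst (ℕ._< j) lo≡1+i (lo<hi idx)
      i<j : i ℕ.< j
      i<j = ℕₚ.<-trans (ℕₚ.n<1+n i) 1+i<j

  dot-ineq-rect : ∀ ℓ → Valid n ℓ → ∀ {p q} → p ℕ.< q → q ℕ.≤ n →
                  dot (proj₁ (ineq n ℓ)) (rect p q) ≡ ℤ→ℚ (rectValue ℓ p q)
  dot-ineq-rect cap _ {p} {q} p<q q≤n =
    trans (dot-unit-rect (ℕₚ.<-≤-trans (ℕₚ.≤-<-trans z≤n p<q) q≤n) ℕₚ.≤-refl p q) (cong ℤ→ℚ (inRect-cap {p = p} q≤n))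
  dot-ineq-rect (column (suc i)) (_ , 1+i<n) {p} {q} p<q q≤n = begin
    dot (e (suc i) n ⊖ e i n) r
      ≡⟨ dot-⊖ˡ (e (suc i) n) (e i n) r ⟩
    dot (e (suc i) n) r - dot (e i n) r
      ≡⟨ cong₂ _-_ (dot-unit-rect 1+i<n ℕₚ.≤-refl p q) (dot-unit-rect (ℕₚ.<-trans (ℕₚ.n<1+n i) 1+i<n) ℕₚ.≤-refl p q) ⟩
    ℤ→ℚ (inRect p q (suc i) n) - ℤ→ℚ (inRect p q i n)
      ≡⟨ ℤ→ℚ-homo-minus (inRect p q (suc i) n) (inRect p q i n) ⟨
    ℤ→ℚ (inRect p q (suc i) n ℤ.- inRect p q i n)
      ≡⟨ cong ℤ→ℚ (inRect-column {p = p} i q≤n) ⟩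
    ℤ→ℚ (rectValue (column (suc i)) p q) ∎
    where
    open ≡-Reasoning
    e = unit n
    r = rect p q
  dot-ineq-rect (row i) (1≤i , i<n) {p} {q} p<q q≤n = begin
    dot (e 0 i ⊖ e 0 (suc i)) r
      ≡⟨ dot-⊖ˡ (e 0 i) (e 0 (suc i)) r ⟩
    dot (e 0 i) r - dot (e 0 (suc i)) r
      ≡⟨ cong₂ _-_ (dot-unit-rect 1≤i (ℕₚ.<⇒≤ i<n) p q) (dot-unit-rect (s≤s z≤n) i<n p q) ⟩
    ℤ→ℚ (inRect p q 0 i) - ℤ→ℚ (inRect p q 0 (suc i))
      ≡⟨ ℤ→ℚ-homo-minus (inRect p q 0 i) (inRect p q 0 (suc i)) ⟨
    ℤ→ℚ (inRect p q 0 i ℤ.- inRect p q 0 (suc i))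
      ≡⟨ cong ℤ→ℚ (inRect-row {p = p} {q} i) ⟩
    ℤ→ℚ (rectValue (row i) p q) ∎
    where
    open ≡-Reasoning
    e = unit n
    r = rect p q
  dot-ineq-rect (triangle (suc i)) (_ , 1+i<n) {p} {q} p<q q≤n = begin
    dot (e i (suc (suc i)) ⊖ e i (suc i) ⊖ e (suc i) (suc (suc i))) r
      ≡⟨ trans (dot-⊖ˡ (e i (suc (suc i)) ⊖ e i (suc i)) (e (suc i) (suc (suc i))) r)
               (cong (_- dot (e (suc i) (suc (suc i))) r) (dot-⊖ˡ (e i (suc (suc i))) (e i (suc i)) r)) ⟩
    dot (e i (suc (suc i))) r - dot (e i (suc i)) r - dot (e (suc i) (suc (suc i))) r
      ≡⟨ cong₂ _-_ (cong₂ _-_ (dot-unit-rect (ℕₚ.<-trans (ℕₚ.n<1+n i) (ℕₚ.n<1+n (suc i))) 1+i<n p q)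
                              (dot-unit-rect (ℕₚ.n<1+n i) (ℕₚ.<⇒≤ 1+i<n) p q))
                   (dot-unit-rect (ℕₚ.n<1+n (suc i)) 1+i<n p q) ⟩
    ℤ→ℚ x - ℤ→ℚ y - ℤ→ℚ z
      ≡⟨ trans (ℤ→ℚ-homo-minus (x ℤ.- y) z) (cong (_- ℤ→ℚ z) (ℤ→ℚ-homo-minus x y)) ⟨
    ℤ→ℚ (x ℤ.- y ℤ.- z)
      ≡⟨ cong ℤ→ℚ (inRect-triangle i p<q) ⟩
    ℤ→ℚ (rectValue (triangle (suc i)) p q) ∎
    where
    open ≡-Reasoning
    e = unit n
    r = rect p q
    x = inRect p q i (suc (suc i))
    y = inRect p q i (suc i)
    z = inRect p q (suc i) (suc (suc i))
  dot-ineq-rect (square j (suc k)) (3+j≤1+k , 1+k≤n) {p} {q} p<q q≤n = begin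
    dot (e j (suc k) ⊕ e (suc j) k ⊖ e (suc j) (suc k) ⊖ e j k) r
      ≡⟨ trans (dot-⊖ˡ (e j (suc k) ⊕ e (suc j) k ⊖ e (suc j) (suc k)) (e j k) r)
         (cong (_- dot (e j k) r) (trans (dot-⊖ˡ (e j (suc k) ⊕ e (suc j) k) (e (suc j) (suc k)) r)
         (cong (_- dot (e (suc j) (suc k)) r) (dot-⊕ˡ (e j (suc k)) (e (suc j) k) r)))) ⟩
    dot (e j (suc k)) r + dot (e (suc j) k) r - dot (e (suc j) (suc k)) r - dot (e j k) r
      ≡⟨ cong₂ _-_ (cong₂ _-_ (cong₂ _+_ (dot-unit-rect j<1+k 1+k≤n p q) (dot-unit-rect 1+j<k k≤n p q))
                              (dot-unit-rect 1+j<1+k 1+k≤n p q))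
                   (dot-unit-rect j<k k≤n p q) ⟩
    ℤ→ℚ x + ℤ→ℚ y - ℤ→ℚ z - ℤ→ℚ w
      ≡⟨ trans (ℤ→ℚ-homo-minus (x ℤ.+ y ℤ.- z) w) (cong (_- ℤ→ℚ w)
         (trans (ℤ→ℚ-homo-minus (x ℤ.+ y) z) (cong (_- ℤ→ℚ z) (ℤ→ℚ-homo-+ x y)))) ⟨
    ℤ→ℚ (x ℤ.+ y ℤ.- z ℤ.- w)
      ≡⟨ cong ℤ→ℚ (inRect-square {p} {q} j k) ⟩
    ℤ→ℚ (rectValue (square j (suc k)) p q) ∎
    where
    open ≡-Reasoning
    e = unit n
    r = rect p q
    x = inRect p q j (suc k)
    y = inRect p q (suc j) k
    z = inRect p q (suc j) (suc k)
    w = inRect p q j k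
    1+j<k : suc j ℕ.< k
    1+j<k = ℕₚ.≤-pred 3+j≤1+k
    j<k : j ℕ.< k
    j<k = ℕₚ.<-trans (ℕₚ.n<1+n j) 1+j<k
    1+j<1+k : suc j ℕ.< suc k
    1+j<1+k = ℕₚ.m<n⇒m<1+n 1+j<k
    j<1+k : j ℕ.< suc k
    j<1+k = ℕₚ.m<n⇒m<1+n j<k
    k≤n : k ℕ.≤ n
    k≤n = ℕₚ.<⇒≤ 1+k≤n

-- Optimality of the integral dual

open Indicators using (δ; _==_; 𝟙-nonneg; rectValue-split; δ-square-adjacent)

*-nonneg : ∀ {x y} → 0ℚ ≤ x → 0ℚ ≤ y → 0ℚ ≤ x * y
*-nonneg {x} {y} 0≤x 0≤y =
  ℚₚ.nonNegative⁻¹ (x * y) {{ℚₚ.nonNeg*nonNeg⇒nonNeg x {{ℚ.nonNegative 0≤x}} y {{ℚ.nonNegative 0≤y}}}}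

module _ (n : ℕ) (z : Fin (numCons n) → ℚ) where

  mass : (Ineq → ℤ) → ℚ
  mass F = sumFin (λ r → z r * ℤ→ℚ (F (ineqAt n r)))

  mass-cong : ∀ {F G} → (∀ ℓ → F ℓ ≡ G ℓ) → mass F ≡ mass G
  mass-cong F≗G = sumFin-cong (λ r → cong (λ v → z r * ℤ→ℚ v) (F≗G (ineqAt n r)))

  mass-+ : ∀ F G → mass (λ ℓ → F ℓ ℤ.+ G ℓ) ≡ mass F + mass G
  mass-+ F G = trans (sumFin-cong λ r → trans (cong (z r *_) (ℤ→ℚ-homo-+ (F (ineqAt n r)) (G (ineqAt n r))))
                                             (ℚₚ.*-distribˡ-+ (z r) (ℤ→ℚ (F (ineqAt n r))) (ℤ→ℚ (G (ineqAt n r)))))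
                     (sumFin-distrib-+ (λ r → z r * ℤ→ℚ (F (ineqAt n r))) (λ r → z r * ℤ→ℚ (G (ineqAt n r))))

  mass-minus : ∀ F G → mass (λ ℓ → F ℓ ℤ.- G ℓ) ≡ mass F - mass G
  mass-minus F G = trans (mass-+ F (λ ℓ → ℤ.- G ℓ)) (cong (mass F +_) (trans
    (sumFin-cong λ r → trans (cong (z r *_) (ℤ→ℚ-homo‿- (G (ineqAt n r))))
                             (sym (ℚₚ.neg-distribʳ-* (z r) (ℤ→ℚ (G (ineqAt n r))))))
    (sumFin-neg (λ r → z r * ℤ→ℚ (G (ineqAt n r))))))

  mass-scale : ∀ k F → mass (λ ℓ → k ℤ.* F ℓ) ≡ ℤ→ℚ k * mass F
  mass-scale k F = trans (sumFin-cong λ r → trans (cong (z r *_) (ℤ→ℚ-homo-* k (F (ineqAt n r))))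
                                                 (solve 3 (λ a b c → a :* (b :* c) := b :* (a :* c))
                                                          refl (z r) (ℤ→ℚ k) (ℤ→ℚ (F (ineqAt n r)))))
                         (sumFin-*ˡ (ℤ→ℚ k) (λ r → z r * ℤ→ℚ (F (ineqAt n r))))
    where open +-*-Solver

  mass-rectValue : ∀ p q → mass (λ ℓ → rectValue ℓ p (suc q)) ≡
    mass (δ cap) - mass (δ (column (suc p))) - mass (δ (row q))
      + ℤ→ℚ (𝟙 (q ≡ᵇ suc p)) * mass (δ (triangle (suc p))) + mass (δ (square p (suc q)))
  mass-rectValue p q = begin
    mass (λ ℓ → rectValue ℓ p (suc q))
      ≡⟨ mass-cong (λ ℓ → rectValue-split ℓ p q) ⟩
    mass (λ ℓ → Cap ℓ ℤ.- Col ℓ ℤ.- Row ℓ ℤ.+ k ℤ.* Tri ℓ ℤ.+ Sq ℓ)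
      ≡⟨ trans (mass-+ (λ ℓ → Cap ℓ ℤ.- Col ℓ ℤ.- Row ℓ ℤ.+ k ℤ.* Tri ℓ) Sq)
               (cong (_+ mass Sq) (trans (mass-+ (λ ℓ → Cap ℓ ℤ.- Col ℓ ℤ.- Row ℓ) (λ ℓ → k ℤ.* Tri ℓ))
                 (cong₂ _+_ (trans (mass-minus (λ ℓ → Cap ℓ ℤ.- Col ℓ) Row) (cong (_- mass Row) (mass-minus Cap Col)))
                            (mass-scale k Tri)))) ⟩
    mass Cap - mass Col - mass Row + ℤ→ℚ k * mass Tri + mass Sq ∎
    where
    open ≡-Reasoning
    Cap Col Row Tri Sq : Ineq → ℤ
    Cap = δ cap
    Col = δ (column (suc p))
    Row = δ (row q)
    Tri = δ (triangle (suc p))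
    Sq  = δ (square p (suc q))
    k = 𝟙 (q ≡ᵇ suc p)

  mass-δ-nonneg : (∀ r → 0ℚ ≤ z r) → ∀ m → 0ℚ ≤ mass (δ m)
  mass-δ-nonneg z≥0 m = sumFin-nonneg (λ r → *-nonneg (z≥0 r) (ℤ→ℚ-mono-≤ (𝟙-nonneg (ineqAt n r == m))))

  dot-bvec : dot (bvec n) z ≡ mass (δ cap)
  dot-bvec = sumFin-cong λ r → trans (cong (_* z r) (trans (bvec≡ineqAt n r) (bound (ineqAt n r))))
                                     (ℚₚ.*-comm (ℤ→ℚ (δ cap (ineqAt n r))) (z r))
    where
    bound : ∀ ℓ → proj₂ (ineq n ℓ) ≡ ℤ→ℚ (δ cap ℓ)
    bound cap          = refl
    bound (column _)   = refl
    bound (row _)      = refl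
    bound (triangle _) = refl
    bound (square _ _) = refl

  dot-Aᵀ-rect : ∀ {p q} → p ℕ.< q → q ℕ.≤ n →
                dot (λ j → sumFin (λ r → Amat n r j * z r)) (rect n p q) ≡ mass (λ ℓ → rectValue ℓ p q)
  dot-Aᵀ-rect {p} {q} p<q q≤n = trans (dot-transpose (Amat n) z (rect n p q)) (sumFin-cong λ r → cong (z r *_)
    (trans (cong (λ v → dot v (rect n p q)) (Amat≡ineqAt n r)) (dot-ineq-rect n (ineqAt n r) (valid-ineqAt n r) p<q q≤n)))

  mass-square-adjacent : ∀ p → mass (δ (square p (suc p))) ≡ 0ℚ
  mass-square-adjacent p = sumFin-zero λ r →
    trans (cong (λ v → z r * ℤ→ℚ v) (δ-square-adjacent (ineqAt n r) (valid-ineqAt n r) p)) (ℚₚ.*-zeroʳ (z r))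

mass-integral : ∀ n (w F : Ineq → ℤ) →
                mass n (λ r → ℤ→ℚ (w (ineqAt n r))) F ≡ ℤ→ℚ (sumList (λ ℓ → w ℓ ℤ.* F ℓ) (ineqs n))
mass-integral n w F = trans (sumFin-cong λ r → sym (ℤ→ℚ-homo-* (w (ineqAt n r)) (F (ineqAt n r))))
                            (sumFin-origin (ineq n) (λ ℓ → w ℓ ℤ.* F ℓ) (ineqs n) (system≡map-ineq n))

p≤p+q : ∀ {p q} → 0ℚ ≤ q → p ≤ p + q
p≤p+q {p} 0≤q = ℚₚ.≤-trans (ℚₚ.≤-reflexive (sym (ℚₚ.+-identityʳ p))) (ℚₚ.+-monoʳ-≤ p 0≤q)

p-q≤p : ∀ {p q} → 0ℚ ≤ q → p - q ≤ p
p-q≤p {p} 0≤q = ℚₚ.≤-trans (ℚₚ.+-monoʳ-≤ p (ℚₚ.neg-antimono-≤ 0≤q)) (ℚₚ.≤-reflexive (ℚₚ.+-identityʳ p))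

-- For a rational dual solution, a k, b k and W p q are the total weights of the inequalities
-- that play the roles of α k, β k and γ p q.
module LowerBound (n : ℕ) (g : ℕ → ℕ → ℤ) (z₀ : ℚ) (a b : ℕ → ℚ) (W : ℕ → ℕ → ℚ)
  (z₀≥0 : 0ℚ ≤ z₀) (a≥0 : ∀ k → 0ℚ ≤ a k) (b≥0 : ∀ k → 0ℚ ≤ b k) (W≥0 : ∀ p q → 0ℚ ≤ W p q)
  (adjacent : ∀ {k} → k ℕ.< n → z₀ - a k - b k ≡ ℤ→ℚ (g k (suc k)))
  (distant : ∀ {p q} → 2 ℕ.+ p ℕ.≤ q → q ℕ.≤ n → z₀ - a p - b (q ∸ 1) + W p q ≡ ℤ→ℚ (g p q))
  where

  open LongestPaths n g
  open DualSolution n g using (y₀)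
  open IntegerFolds using (maxUpTo-attained)
  open ℚₚ.≤-Reasoning

  a-step : ∀ {j k} → j ℕ.< k → k ℕ.≤ n ∸ 1 → a k - ℤ→ℚ (edge j k) ≤ a j
  a-step {j} {k} j<k k≤n-1 = begin
    a k - ℤ→ℚ (edge j k)                ≤⟨ p≤p+q (W≥0 j (suc k)) ⟩
    a k - ℤ→ℚ (edge j k) + W j (suc k)  ≡⟨ cong (λ e → a k - e + W j (suc k)) edge≡ ⟩
    a k - ((z₀ - a j - b k + W j (suc k)) - (z₀ - a k - b k)) + W j (suc k)
                                        ≡⟨ solve 5 (λ z aj ak bk w → ak :- ((z :- aj :- bk :+ w) :- (z :- ak :- bk)) :+ w := aj)
                                                 refl z₀ (a j) (a k) (b k) (W j (suc k)) ⟩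
    a j                                 ∎
    where
    open +-*-Solver
    k<n : k ℕ.< n
    k<n = ≤∸1⇒< n (ℕₚ.≤-trans (s≤s z≤n) j<k) k≤n-1
      where
      ≤∸1⇒< : ∀ m {k} → 1 ℕ.≤ k → k ℕ.≤ m ∸ 1 → k ℕ.< m
      ≤∸1⇒< zero    (s≤s _) ()
      ≤∸1⇒< (suc m) _       k≤m = s≤s k≤m
    edge≡ : ℤ→ℚ (edge j k) ≡ (z₀ - a j - b k + W j (suc k)) - (z₀ - a k - b k)
    edge≡ = trans (ℤ→ℚ-homo-minus (g j (suc k)) (g k (suc k)))
                  (sym (cong₂ _-_ (distant (s≤s j<k) k<n) (adjacent k<n)))

  longest≤a : ∀ f k → k ℕ.≤ n ∸ 1 → ℤ→ℚ (longest f k) ≤ a k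
  longest≤a zero    k _ = a≥0 k
  longest≤a (suc f) k k≤n-1 with maxUpTo-attained (n ∸ 1 ∸ k) (λ t → longest f (suc k ℕ.+ t) ℤ.- edge k (suc k ℕ.+ t))
  ... | inj₁ max≡0 = ℚₚ.≤-trans (ℚₚ.≤-reflexive (cong ℤ→ℚ max≡0)) (a≥0 k)
  ... | inj₂ (t , t<n-1-k , max≡) = begin
    ℤ→ℚ (longest (suc f) k)                            ≡⟨ cong ℤ→ℚ max≡ ⟩
    ℤ→ℚ (longest f k′ ℤ.- edge k k′)                   ≡⟨ ℤ→ℚ-homo-minus (longest f k′) (edge k k′) ⟩
    ℤ→ℚ (longest f k′) - ℤ→ℚ (edge k k′)               ≤⟨ ℚₚ.+-monoˡ-≤ (- ℤ→ℚ (edge k k′)) (longest≤a f k′ k′≤n-1) ⟩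
    a k′ - ℤ→ℚ (edge k k′)                             ≤⟨ a-step (s≤s (ℕₚ.m≤m+n k t)) k′≤n-1 ⟩
    a k                                                ∎
    where
    k′ = suc k ℕ.+ t
    k′≤n-1 : k′ ℕ.≤ n ∸ 1
    k′≤n-1 = ℕₚ.≤-trans (ℕₚ.+-monoʳ-< k t<n-1-k) (ℕₚ.≤-reflexive (ℕₚ.m+[n∸m]≡n k≤n-1))

  y₀≤z₀ : ℤ→ℚ y₀ ≤ z₀
  y₀≤z₀ with maxUpTo-attained n (λ k → dist k ℤ.+ g k (suc k))
  ... | inj₁ y₀≡0 = ℚₚ.≤-trans (ℚₚ.≤-reflexive (cong ℤ→ℚ y₀≡0)) z₀≥0
  ... | inj₂ (t , t<n , y₀≡) = begin
    ℤ→ℚ y₀                                ≡⟨ trans (cong ℤ→ℚ y₀≡) (ℤ→ℚ-homo-+ (dist t) (g t (suc t))) ⟩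
    ℤ→ℚ (dist t) + ℤ→ℚ (g t (suc t))      ≤⟨ ℚₚ.+-monoˡ-≤ _ (longest≤a (n ∸ 1 ∸ t) t (ℕₚ.∸-monoˡ-≤ 1 t<n)) ⟩
    a t + ℤ→ℚ (g t (suc t))               ≡⟨ cong (a t +_) (adjacent t<n) ⟨
    a t + (z₀ - a t - b t)                ≡⟨ solve 3 (λ at z bt → at :+ (z :- at :- bt) := z :- bt) refl (a t) z₀ (b t) ⟩
    z₀ - b t                              ≤⟨ p-q≤p (b≥0 t) ⟩
    z₀                                    ∎
    where open +-*-Solver

module RationalDual (n : ℕ) (g : ℕ → ℕ → ℤ) (z : Fin (numCons n) → ℚ) (z≥0 : ∀ r → 0ℚ ≤ z r)
  (Aᵀz-rect : ∀ p q → dot (λ j → sumFin (λ r → Amat n r j * z r)) (rect n p q) ≡ ℤ→ℚ (g p q))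
  where

  open ≡-Reasoning

  M : Ineq → ℚ
  M m = mass n z (δ m)

  W : ℕ → ℕ → ℚ
  W p q = ℤ→ℚ (𝟙 (q ≡ᵇ suc (suc p))) * M (triangle (suc p)) + M (square p q)

  W≥0 : ∀ p q → 0ℚ ≤ W p q
  W≥0 p q = ℚₚ.≤-trans (ℚₚ.≤-reflexive (sym (ℚₚ.+-identityʳ 0ℚ)))
    (ℚₚ.+-mono-≤ (*-nonneg (ℤ→ℚ-mono-≤ (𝟙-nonneg (q ≡ᵇ suc (suc p)))) (mass-δ-nonneg n z z≥0 (triangle (suc p))))
                 (mass-δ-nonneg n z z≥0 (square p q)))

  dual-equation : ∀ {p q} → p ℕ.< suc q → suc q ℕ.≤ n →
    M cap - M (column (suc p)) - M (row q) + W p (suc q) ≡ ℤ→ℚ (g p (suc q))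
  dual-equation {p} {q} p<q q≤n = begin
    M cap - M (column (suc p)) - M (row q) + W p (suc q)
      ≡⟨ ℚₚ.+-assoc (M cap - M (column (suc p)) - M (row q)) (ℤ→ℚ (𝟙 (q ≡ᵇ suc p)) * M (triangle (suc p)))
                    (M (square p (suc q))) ⟨
    M cap - M (column (suc p)) - M (row q) + ℤ→ℚ (𝟙 (q ≡ᵇ suc p)) * M (triangle (suc p)) + M (square p (suc q))
      ≡⟨ mass-rectValue n z p q ⟨
    mass n z (λ ℓ → rectValue ℓ p (suc q))
      ≡⟨ dot-Aᵀ-rect n z p<q q≤n ⟨
    dot (λ j → sumFin (λ r → Amat n r j * z r)) (rect n p (suc q))
      ≡⟨ Aᵀz-rect p (suc q) ⟩
    ℤ→ℚ (g p (suc q)) ∎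

  W-adjacent : ∀ k → W k (suc k) ≡ 0ℚ
  W-adjacent k = begin
    ℤ→ℚ (𝟙 (k ≡ᵇ suc k)) * M (triangle (suc k)) + M (square k (suc k))
      ≡⟨ cong₂ (λ b s → ℤ→ℚ (𝟙 b) * M (triangle (suc k)) + s)
               (≢⇒≡ᵇ-false (ℕₚ.<⇒≢ (ℕₚ.n<1+n k))) (mass-square-adjacent n z k) ⟩
    0ℚ * M (triangle (suc k)) + 0ℚ
      ≡⟨ trans (ℚₚ.+-identityʳ (0ℚ * M (triangle (suc k)))) (ℚₚ.*-zeroˡ (M (triangle (suc k)))) ⟩
    0ℚ ∎

  adjacent : ∀ {k} → k ℕ.< n → M cap - M (column (suc k)) - M (row k) ≡ ℤ→ℚ (g k (suc k))
  adjacent {k} k<n = begin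
    M cap - M (column (suc k)) - M (row k)                 ≡⟨ ℚₚ.+-identityʳ _ ⟨
    M cap - M (column (suc k)) - M (row k) + 0ℚ            ≡⟨ cong (M cap - M (column (suc k)) - M (row k) +_) (W-adjacent k) ⟨
    M cap - M (column (suc k)) - M (row k) + W k (suc k)   ≡⟨ dual-equation (ℕₚ.n<1+n k) k<n ⟩
    ℤ→ℚ (g k (suc k))                                      ∎

  distant : ∀ {p q} → 2 ℕ.+ p ℕ.≤ q → q ℕ.≤ n →
            M cap - M (column (suc p)) - M (row (q ∸ 1)) + W p q ≡ ℤ→ℚ (g p q)
  distant {p} {suc q} (s≤s 1+p≤q) q≤n = dual-equation (ℕₚ.m<n⇒m<1+n 1+p≤q) q≤n

  y₀≤cost : ℤ→ℚ (DualSolution.y₀ n g) ≤ dot (bvec n) z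
  y₀≤cost = ℚₚ.≤-trans
    (LowerBound.y₀≤z₀ n g (M cap) (M ∘ column ∘ ℕ.suc) (M ∘ row) W
      (mass-δ-nonneg n z z≥0 cap) (mass-δ-nonneg n z z≥0 ∘ column ∘ ℕ.suc) (mass-δ-nonneg n z z≥0 ∘ row) W≥0
      adjacent distant)
    (ℚₚ.≤-reflexive (sym (dot-bvec n z)))

module IntegralDual (n : ℕ) (2≤n : 2 ℕ.≤ n) (c : Fin (numVars n) → ℤ) where

  c′ : Vec' n
  c′ j = ℤ→ℚ (c j)

  g : ℕ → ℕ → ℤ
  g p q = ℤΣ.sum (λ idx → c idx ℤ.* inRect p q (lo n idx) (hi n idx))

  c′·rect : ∀ p q → dot c′ (rect n p q) ≡ ℤ→ℚ (g p q)
  c′·rect p q = sym (trans (ℤ→ℚ-sum (λ idx → c idx ℤ.* inRect p q (lo n idx) (hi n idx)))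
                          (sumFin-cong (λ idx → ℤ→ℚ-homo-* (c idx) (inRect p q (lo n idx) (hi n idx)))))

  open DualSolution n g using (weight; weight-nonneg; weight-rectValue; weight-cap)
  open DualSolution n g public using (y₀)

  y : Fin (numCons n) → ℤ
  y r = weight (ineqAt n r)

  y′ : Fin (numCons n) → ℚ
  y′ r = ℤ→ℚ (y r)

  y-feasible : DualFeasible (Amat n) c′ y′
  y-feasible = (λ r → ℤ→ℚ-mono-≤ (weight-nonneg (ℕₚ.≤-trans (s≤s z≤n) 2≤n) (ineqAt n r) (valid-ineqAt n r)))
             , rects-determine n (λ j → sumFin (λ r → Amat n r j * y′ r)) c′ agree
    where
    open ≡-Reasoning
    agree : ∀ {p q} → p ℕ.< q → q ℕ.≤ n → Agree (λ j → sumFin (λ r → Amat n r j * y′ r)) c′ (rect n p q)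
    agree {p} {q} p<q q≤n = begin
      dot (λ j → sumFin (λ r → Amat n r j * y′ r)) (rect n p q)  ≡⟨ dot-Aᵀ-rect n y′ p<q q≤n ⟩
      mass n y′ (λ ℓ → rectValue ℓ p q)                          ≡⟨ mass-integral n weight (λ ℓ → rectValue ℓ p q) ⟩
      ℤ→ℚ (sumList (λ ℓ → weight ℓ ℤ.* rectValue ℓ p q) (ineqs n)) ≡⟨ cong ℤ→ℚ (weight-rectValue 2≤n p<q q≤n) ⟩
      ℤ→ℚ (g p q)                                              ≡⟨ c′·rect p q ⟨
      dot c′ (rect n p q)                                      ∎

  y-cost : dot (bvec n) y′ ≡ ℤ→ℚ y₀
  y-cost = trans (dot-bvec n y′) (trans (mass-integral n weight (δ cap)) (cong ℤ→ℚ weight-cap))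

  y₀-optimal : ∀ z → DualFeasible (Amat n) c′ z → ℤ→ℚ y₀ ≤ dot (bvec n) z
  y₀-optimal z (z≥0 , Aᵀz≡c) =
    RationalDual.y₀≤cost n g z z≥0 λ p q → trans (dot-congˡ (rect n p q) Aᵀz≡c) (c′·rect p q)

theorem1 : (n : ℕ) → 2 ℕ.≤ n → TDI (Amat n) (bvec n)
theorem1 n 2≤n c _ _ = y , y-feasible , λ z z-feasible → begin
  dot (bvec n) (λ r → ℤ→ℚ (y r))  ≡⟨ y-cost ⟩
  ℤ→ℚ y₀                          ≤⟨ y₀-optimal z z-feasible ⟩
  dot (bvec n) z                  ∎
  where
  open IntegralDual n 2≤n c
  open ℚₚ.≤-Reasoning
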